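{- Let $m,k$ be integers such that $k$ divides $m$ and $\gcd(2^m-1,2^k+1)=1$, let $e=2^m-2^k-2$ and let $d$ be the inverse of $e$ modulo $2^m-1$. Let $u,v\in\mathbb{F}_{2^m}$ and $\gamma\in\mathbb{F}_{2^k}$. (i) If $v\neq0$, then \[ \Omega_\gamma=\sum_{s\in\mathbb{F}_{2^m}:\,{\rm Tr}^m_k(s)=\gamma}\ \sum_{x\in\mathbb{F}_{2^m}^*}(-1)^{{\rm Tr}_m(ux)\oplus{\rm Tr}_m(vsx^{2^k+1})}=\begin{cases}2^m-2^{m-k}, & \gamma={\rm Tr}^m_k(uv^d)^2,\\ -2^{m-k}, &\text{otherwise.}\end{cases} \] (ii) If $u\neq0$, then \[ \Upsilon_\gamma=\sum_{s\in\mathbb{F}_{2^m}:\,{\rm Tr}^m_k(s)=\gamma}\ \sum_{x\in\mathbb{F}_{2^m}^*}(-1)^{{\rm Tr}_m(usx^{ -d})\oplus{\rm Tr}_m(vx)}=\begin{cases}2^m-2^{m-k}, & \gamma^2={\rm Tr}^m_k(vu^e),\\ -2^{m-k}, &\text{otherwise.}\end{cases} \]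
   Context: ${\rm Tr}_m$ is the absolute trace $\mathbb{F}_{2^m}\to\mathbb{F}_2$, ${\rm Tr}^m_k$ is the relative trace $\mathbb{F}_{2^m}\to\mathbb{F}_{2^k}$; powers of nonzero elements have exponents modulo $2^m-1$, and all powers of $0$ equal $0$. -}

module Defs where

open import Level using (0ℓ)
open import Data.Nat as ℕ using (ℕ; zero; suc)
open import Data.Integer as ℤ using (ℤ)
open import Data.List using (List; []; _∷_; length; filter)
open import Data.List.Membership.Propositional using (_∈_)
open import Data.List.Relation.Unary.Unique.Propositional using (Unique)
open import Data.Product using (∃)
open import Algebra.Core using (Op₁; Op₂)
open import Algebra.Structures using (IsCommutativeRing)
open import Relation.Binary.PropositionalEquality using (_≡_; _≢_)
open import Relation.Binary.Definitions using (DecidableEquality)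
open import Relation.Nullary using (yes; no; ¬?)

record GF (m : ℕ) : Set₁ where
  infixl 7 _*_
  infixl 6 _+_
  field
    Carrier   : Set
    _+_ _*_   : Op₂ Carrier
    -_        : Op₁ Carrier
    0# 1#     : Carrier
    isCommutativeRing : IsCommutativeRing _≡_ _+_ _*_ -_ 0# 1#
    0≢1       : 0# ≢ 1#
    inverse   : ∀ x → x ≢ 0# → ∃ λ y → x * y ≡ 1#
    _≟_       : DecidableEquality Carrier
    elems     : List Carrier
    elems-unique   : Unique elems
    elems-complete : ∀ x → x ∈ elems
    card      : length elems ≡ 2 ℕ.^ m

module GFOps {m : ℕ} (F : GF m) where
  open GF F

  _^ⁿ_ : Carrier → ℕ → Carrier
  x ^ⁿ zero  = 1#
  x ^ⁿ suc n = x * (x ^ⁿ n)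

  -- the paper's power convention: powers of 0 are 0; for nonzero x the
  -- exponent only matters modulo 2^m - 1 (automatic in the field)
  pw : Carrier → ℕ → Carrier
  pw x n with x ≟ 0#
  ... | yes _ = 0#
  ... | no  _ = x ^ⁿ n

  -- x^{-n} := x^{(2^m - 2) n}, which is (x^n)^{-1} for x ≠ 0 and 0 for x = 0
  pw⁻ : Carrier → ℕ → Carrier
  pw⁻ x n = pw x ((2 ℕ.^ m ℕ.∸ 2) ℕ.* n)

  Σ< : ℕ → (ℕ → Carrier) → Carrier
  Σ< zero    f = 0#
  Σ< (suc n) f = Σ< n f + f n

  Tr : Carrier → Carrier
  Tr x = Σ< m (λ i → x ^ⁿ (2 ℕ.^ i))

  -- relative trace Tr^m_k, where q = m / k
  RelTr : (k q : ℕ) → Carrier → Carrier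
  RelTr k q x = Σ< q (λ i → x ^ⁿ (2 ℕ.^ (k ℕ.* i)))

  InSubfield : ℕ → Carrier → Set
  InSubfield k γ = γ ^ⁿ (2 ℕ.^ k) ≡ γ

  sgn : Carrier → ℤ
  sgn t with t ≟ 0#
  ... | yes _ = ℤ.+ 1
  ... | no  _ = ℤ.- (ℤ.+ 1)

  sumℤ : List Carrier → (Carrier → ℤ) → ℤ
  sumℤ []       f = ℤ.+ 0
  sumℤ (x ∷ xs) f = f x ℤ.+ sumℤ xs f

  sumNZ : (Carrier → ℤ) → ℤ
  sumNZ f = sumℤ (filter (λ x → ¬? (x ≟ 0#)) elems) f

  sumFiber : (k q : ℕ) → Carrier → (Carrier → ℤ) → ℤ
  sumFiber k q γ f = sumℤ (filter (λ s → RelTr k q s ≟ γ) elems) f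

eℤ : ℕ → ℕ → ℤ
eℤ m k = ℤ.+ (2 ℕ.^ m) ℤ.- ℤ.+ (2 ℕ.^ k) ℤ.- ℤ.+ 2

-- a nonnegative representative of e modulo 2^m - 1:
-- 3·2^m - 2^k - 4 = e + 2(2^m - 1)  (nonnegative whenever 1 ≤ k ≤ m)
eNat : ℕ → ℕ → ℕ
eNat m k = 3 ℕ.* 2 ℕ.^ m ℕ.∸ 2 ℕ.^ k ℕ.∸ 4

bigVal : ℕ → ℕ → ℤ
bigVal m k = ℤ.+ (2 ℕ.^ m) ℤ.- ℤ.+ (2 ℕ.^ (m ℕ.∸ k))

smallVal : ℕ → ℕ → ℤ
smallVal m k = ℤ.- ℤ.+ (2 ℕ.^ (m ℕ.∸ k))

module _ {m : ℕ} (F : GF m) where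
  open GF F
  open GFOps F

  Ω : (k q : ℕ) → (u v γ : Carrier) → ℤ
  Ω k q u v γ = sumFiber k q γ (λ s → sumNZ (λ x →
    sgn (Tr (u * x)) ℤ.* sgn (Tr (v * s * pw x (2 ℕ.^ k ℕ.+ 1)))))

  Υ : (k q d : ℕ) → (u v γ : Carrier) → ℤ
  Υ k q d u v γ = sumFiber k q γ (λ s → sumNZ (λ x →
    sgn (Tr (u * s * pw⁻ x d)) ℤ.* sgn (Tr (v * x))))

module Submission where

-- Swapping the two summations, Ω_γ and Υ_γ become sums over x ≠ 0 of a character sum
-- Σ_{Tr^m_k(s) = γ} (-1)^{Tr(w s)}; such a sum is |ker Tr^m_k| (-1)^{Tr(w γ)} when w ∈ 𝔽_{2^k}
-- and 0 otherwise (m/k is odd by the gcd hypothesis, so Tr^m_k fixes 𝔽_{2^k}).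
-- Since e d ≡ 1 and 2^k + 1 ≡ -e modulo 2^m - 1, the substitution x = y v^d (resp. x = y u^e)
-- turns w into y^{2^k+1} = y² (resp. y^{-d}, whose square is y) for y ∈ 𝔽_{2^k}; both sums collapse
-- to Σ_{0 ≠ y ∈ 𝔽_{2^k}} 2^{m-k} (-1)^{Tr(y z)} for an explicit z, which by orthogonality is
-- 2^m - 2^{m-k} if Tr^m_k(z) = 0 and -2^{m-k} otherwise. The counts |ker Tr^m_k| = 2^{m-k} and
-- |𝔽_{2^k}| = 2^k follow from |ker Tr^m_k| · |𝔽_{2^k}| = 2^m and root bounds for the monic
-- polynomials Tr^m_k and x^{2^k} + x.

open import Level using (0ℓ)
open import Function using (_∘_)
open import Data.Empty using (⊥-elim)
open import Data.Unit using (⊤; tt)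
open import Data.Bool using (true; false; if_then_else_)
open import Data.Product using (∃; _×_; _,_; proj₁; proj₂)
open import Data.Sum using (_⊎_; inj₁; inj₂)
open import Data.Maybe using (nothing)
open import Data.Nat as ℕ using (ℕ; zero; suc; _≤_; _<_; z≤n; s≤s)
import Data.Nat.Properties as ℕₚ
import Data.Nat.Divisibility as ℕ∣
open import Data.Nat.GCD using (gcd; gcd-greatest)
import Data.Nat.Tactic.RingSolver as ℕ-Solver
open import Data.Integer as ℤ using (ℤ)
import Data.Integer.Properties as ℤₚ
import Data.Integer.Divisibility as ℤ∣
open import Data.Integer.Divisibility.Signed using (divides; ∣ᵤ⇒∣) renaming (_∣_ to _∣ˢ_)
open import Data.Integer.Tactic.RingSolver using (solve-∀)
open import Data.Vec using (Vec; []; _∷_)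
open import Data.List using (List; []; _∷_; map; filter; length)
open import Data.List.Properties using (filter-all)
open import Data.List.Membership.Propositional using (_∈_)
open import Data.List.Membership.Propositional.Properties using (∈-filter⁺; ∈-filter⁻; ∈-map⁺; ∈-map⁻)
open import Data.List.Relation.Unary.All as All using (All; []; _∷_)
open import Data.List.Relation.Unary.Any as Any using (here; there; any?; satisfied)
open import Data.List.Relation.Unary.AllPairs using ([]; _∷_)
open import Data.List.Relation.Unary.Unique.Propositional using (Unique)
import Data.List.Relation.Unary.Unique.Propositional.Properties as Unique
open import Algebra.Bundles using (CommutativeMonoid; CommutativeRing)
open import Algebra.Structures using (IsCommutativeMonoid; IsCommutativeRing)
import Algebra.Properties.CommutativeSemigroup as CommutativeSemigroupProperties
import Algebra.Properties.Group as GroupProperties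
open import Tactic.RingSolver.Core.AlmostCommutativeRing using (fromCommutativeRing)
import Tactic.RingSolver.NonReflective as RingSolver
open import Relation.Nullary using (¬_; Dec; yes; no; does; ¬?; _×-dec_; contradiction)
open import Relation.Binary.Definitions using (DecidableEquality)
open import Relation.Binary.PropositionalEquality

open import Defs

module ListFold {C A : Set} (_≟_ : DecidableEquality C) {_⊕_ : A → A → A} {ε : A}
                (isCM : IsCommutativeMonoid _≡_ _⊕_ ε) where
  open IsCommutativeMonoid isCM using (identityˡ; comm)

  commutativeMonoid : CommutativeMonoid 0ℓ 0ℓ
  commutativeMonoid = record { isCommutativeMonoid = isCM }

  open CommutativeSemigroupProperties (CommutativeMonoid.commutativeSemigroup commutativeMonoid)
    using (interchange; x∙yz≈y∙xz)
  open ≡-Reasoning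

  fold : List C → (C → A) → A
  fold []       f = ε
  fold (x ∷ xs) f = f x ⊕ fold xs f

  remove : C → List C → List C
  remove a = filter (λ x → ¬? (x ≟ a))

  infix 5 _when_
  _when_ : {P : Set} → A → Dec P → A
  a when d = if does d then a else ε

  fold-cong : ∀ xs {f g : C → A} → (∀ x → f x ≡ g x) → fold xs f ≡ fold xs g
  fold-cong []       f≗g = refl
  fold-cong (x ∷ xs) f≗g = cong₂ _⊕_ (f≗g x) (fold-cong xs f≗g)

  fold-map : ∀ xs (σ : C → C) (f : C → A) → fold (map σ xs) f ≡ fold xs (f ∘ σ)
  fold-map []       σ f = refl
  fold-map (x ∷ xs) σ f = cong (f (σ x) ⊕_) (fold-map xs σ f)

  fold-⊕ : ∀ xs (f g : C → A) → fold xs (λ x → f x ⊕ g x) ≡ fold xs f ⊕ fold xs g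
  fold-⊕ []       f g = sym (identityˡ ε)
  fold-⊕ (x ∷ xs) f g = trans (cong ((f x ⊕ g x) ⊕_) (fold-⊕ xs f g)) (interchange _ _ _ _)

  fold-filter : ∀ xs {P : C → Set} (P? : ∀ x → Dec (P x)) (f : C → A)
              → fold (filter P? xs) f ≡ fold xs (λ x → f x when P? x)
  fold-filter []       P? f = refl
  fold-filter (x ∷ xs) P? f with does (P? x)
  ... | true  = cong (f x ⊕_) (fold-filter xs P? f)
  ... | false = trans (fold-filter xs P? f) (sym (identityˡ _))

  fold-remove : ∀ {xs a} (f : C → A) → Unique xs → a ∈ xs → fold xs f ≡ f a ⊕ fold (remove a xs) f
  fold-remove {x ∷ xs} {a} f (x∉xs ∷ uniq) a∈ with x ≟ a
  ... | yes refl = cong (λ ys → f a ⊕ fold ys f)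
                        (sym (filter-all (λ y → ¬? (y ≟ a)) (All.map (λ a≢y y≡a → a≢y (sym y≡a)) x∉xs)))
  ... | no x≢a with a∈
  ...   | here a≡x  = ⊥-elim (x≢a (sym a≡x))
  ...   | there a∈xs = trans (cong (f x ⊕_) (fold-remove f uniq a∈xs)) (x∙yz≈y∙xz _ _ _)

  fold-sameElements : ∀ {xs ys} (f : C → A) → Unique xs → Unique ys
                    → (∀ z → z ∈ xs → z ∈ ys) → (∀ z → z ∈ ys → z ∈ xs) → fold xs f ≡ fold ys f
  fold-sameElements {[]}    {[]}     f _ _ _ _ = refl
  fold-sameElements {[]}    {y ∷ ys} f _ _ _ ys⊆ with ys⊆ y (here refl)
  ... | ()
  fold-sameElements {a ∷ xs} {ys} f (a∉xs ∷ uxs) uys xs⊆ ys⊆ = begin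
    f a ⊕ fold xs f              ≡⟨ cong (f a ⊕_) (fold-sameElements f uxs (Unique.filter⁺ _ uys) xs⊆ys-a ys-a⊆xs) ⟩
    f a ⊕ fold (remove a ys) f   ≡⟨ sym (fold-remove f uys (xs⊆ a (here refl))) ⟩
    fold ys f                    ∎
    where
    xs⊆ys-a : ∀ z → z ∈ xs → z ∈ remove a ys
    xs⊆ys-a z z∈ = ∈-filter⁺ (λ y → ¬? (y ≟ a)) (xs⊆ z (there z∈)) (λ z≡a → All.lookup a∉xs z∈ (sym z≡a))
    ys-a⊆xs : ∀ z → z ∈ remove a ys → z ∈ xs
    ys-a⊆xs z z∈ with ∈-filter⁻ (λ y → ¬? (y ≟ a)) z∈
    ... | z∈ys , z≢a with ys⊆ z z∈ys
    ...   | here z≡a = ⊥-elim (z≢a z≡a)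
    ...   | there p  = p

  fold-ε : ∀ xs → fold xs (λ _ → ε) ≡ ε
  fold-ε []       = refl
  fold-ε (x ∷ xs) = trans (identityˡ _) (fold-ε xs)

  fold-cong-∈ : ∀ xs {f g : C → A} → (∀ x → x ∈ xs → f x ≡ g x) → fold xs f ≡ fold xs g
  fold-cong-∈ []       f≗g = refl
  fold-cong-∈ (x ∷ xs) f≗g = cong₂ _⊕_ (f≗g x (here refl)) (fold-cong-∈ xs (λ y y∈ → f≗g y (there y∈)))

  fold-swap : ∀ xs ys (g : C → C → A) → fold xs (λ x → fold ys (g x)) ≡ fold ys (λ y → fold xs (λ x → g x y))
  fold-swap []       ys g = sym (fold-ε ys)
  fold-swap (x ∷ xs) ys g = trans (cong (fold ys (g x) ⊕_) (fold-swap xs ys g)) (sym (fold-⊕ ys (g x) _))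

  when-yes : ∀ {P : Set} (d : Dec P) a → P → a when d ≡ a
  when-yes (yes _) a _  = refl
  when-yes (no ¬p) a p  = ⊥-elim (¬p p)

  when-no : ∀ {P : Set} (d : Dec P) a → ¬ P → a when d ≡ ε
  when-no (yes p) a ¬p = ⊥-elim (¬p p)
  when-no (no _)  a _  = refl

  when-cong : ∀ {P : Set} (d : Dec P) {a b} → (P → a ≡ b) → a when d ≡ b when d
  when-cong (yes p) a≡b = a≡b p
  when-cong (no _)  a≡b = refl

  when-iff : ∀ {P Q : Set} (d : Dec P) (d' : Dec Q) a → (P → Q) → (Q → P) → a when d ≡ a when d'
  when-iff (yes p) (yes q) a _ _ = refl
  when-iff (yes p) (no ¬q) a f _ = ⊥-elim (¬q (f p))
  when-iff (no ¬p) (yes q) a _ g = ⊥-elim (¬p (g q))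
  when-iff (no ¬p) (no ¬q) a _ _ = refl

  when-comm : ∀ {P Q : Set} (d : Dec P) (d' : Dec Q) a → (a when d') when d ≡ (a when d) when d'
  when-comm (yes _) (yes _) a = refl
  when-comm (yes _) (no _)  a = refl
  when-comm (no _)  (yes _) a = refl
  when-comm (no _)  (no _)  a = refl

  fold-when : ∀ xs {P : Set} (d : Dec P) (f : C → A) → fold xs f when d ≡ fold xs (λ x → f x when d)
  fold-when xs (yes _) f = refl
  fold-when xs (no _)  f = sym (fold-ε xs)

  fold-point : ∀ {xs} → Unique xs → ∀ {c} → c ∈ xs → (h : C → A) → fold xs (λ y → h y when (c ≟ y)) ≡ h c
  fold-point {xs} uniq {c} c∈ h = begin
    fold xs (λ y → h y when (c ≟ y))                            ≡⟨ fold-remove _ uniq c∈ ⟩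
    (h c when (c ≟ c)) ⊕ fold (remove c xs) (λ y → h y when (c ≟ y))  ≡⟨ cong₂ _⊕_ (when-yes (c ≟ c) (h c) refl) (fold-cong-∈ (remove c xs) off-c) ⟩
    h c ⊕ fold (remove c xs) (λ _ → ε)                          ≡⟨ cong (h c ⊕_) (fold-ε (remove c xs)) ⟩
    h c ⊕ ε                                                     ≡⟨ trans (comm _ _) (identityˡ _) ⟩
    h c                                                         ∎
    where
    off-c : ∀ y → y ∈ remove c xs → h y when (c ≟ y) ≡ ε
    off-c y y∈ = when-no (c ≟ y) (h y) (λ c≡y → proj₂ (∈-filter⁻ (λ x → ¬? (x ≟ c)) {xs = xs} y∈) (sym c≡y))

  fold-reindex : ∀ {es} → Unique es → (∀ x → x ∈ es) → (σ τ : C → C)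
               → (∀ x → σ (τ x) ≡ x) → (∀ x → τ (σ x) ≡ x) → (f : C → A) → fold es (f ∘ σ) ≡ fold es f
  fold-reindex {es} uniq complete σ τ στ τσ f = trans (sym (fold-map es σ f))
    (fold-sameElements f (Unique.map⁺ σ-injective uniq) uniq (λ z _ → complete z)
      (λ z _ → subst (_∈ map σ es) (στ z) (∈-map⁺ σ (complete (τ z)))))
    where
    σ-injective : ∀ {x y} → σ x ≡ σ y → x ≡ y
    σ-injective {x} {y} σx≡σy = trans (sym (τσ x)) (trans (cong τ σx≡σy) (τσ y))

*-tightˡ : ∀ {a A b B} → a ≤ A → b ≤ B → a ℕ.* b ≡ A ℕ.* B → 0 < B → a ≡ A
*-tightˡ {a} {A} {b} {B} a≤A b≤B ab≡AB 0<B with a ℕ.≟ A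
... | yes a≡A = a≡A
... | no  a≢A = contradiction ab≡AB (ℕₚ.<⇒≢ (ℕₚ.≤-<-trans (ℕₚ.*-monoʳ-≤ a b≤B) (ℕₚ.*-monoˡ-< B (ℕₚ.≤∧≢⇒< a≤A a≢A))))
  where instance _ = ℕ.>-nonZero 0<B

module Congruences where
  open import Data.Integer using (+_; -[1+_]; _+_; _-_; _*_; -_)
  open ≡-Reasoning

  ∣ˢ[+a-+b]⇒a≡b+nM⊎b≡a+nM : ∀ {M} a b → + M ∣ˢ (+ a - + b) → ∃ λ n → a ≡ b ℕ.+ n ℕ.* M ⊎ b ≡ a ℕ.+ n ℕ.* M
  ∣ˢ[+a-+b]⇒a≡b+nM⊎b≡a+nM {M} a b (divides (+ n) a-b≡nM) = n , inj₁ (ℤₚ.+-injective (begin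
    + a                      ≡⟨ a≡[a-b]+b (+ a) (+ b) ⟩
    (+ a - + b) + + b        ≡⟨ cong (_+ + b) a-b≡nM ⟩
    + n * + M + + b          ≡⟨ ℤₚ.+-comm (+ n * + M) (+ b) ⟩
    + b + + n * + M          ≡⟨ cong (λ i → + b + i) (sym (ℤₚ.pos-* n M)) ⟩
    + b + + (n ℕ.* M)        ≡⟨ sym (ℤₚ.pos-+ b (n ℕ.* M)) ⟩
    + (b ℕ.+ n ℕ.* M)        ∎))
    where
    a≡[a-b]+b : ∀ a b → a ≡ (a - b) + b
    a≡[a-b]+b = solve-∀
  ∣ˢ[+a-+b]⇒a≡b+nM⊎b≡a+nM {M} a b (divides -[1+ n ] a-b≡-[1+n]M)
    with ∣ˢ[+a-+b]⇒a≡b+nM⊎b≡a+nM b a (divides (+ suc n) b-a≡[1+n]M)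
    where
    b-a≡[1+n]M : + b - + a ≡ + suc n * + M
    b-a≡[1+n]M = begin
      + b - + a                  ≡⟨ b-a≡-[a-b] (+ a) (+ b) ⟩
      - (+ a - + b)              ≡⟨ cong -_ a-b≡-[1+n]M ⟩
      - (-[1+ n ] * + M)         ≡⟨ ℤₚ.neg-distribˡ-* -[1+ n ] (+ M) ⟩
      + suc n * + M              ∎
      where
      b-a≡-[a-b] : ∀ a b → b - a ≡ - (a - b)
      b-a≡-[a-b] = solve-∀
  ... | n′ , inj₁ b≡a+nM = n′ , inj₂ b≡a+nM
  ... | n′ , inj₂ a≡b+nM = n′ , inj₁ a≡b+nM

  eNat+2^k+4≡3*2^m : ∀ {m k} → k ≤ m → 1 ≤ k → eNat m k ℕ.+ (2 ℕ.^ k ℕ.+ 4) ≡ 3 ℕ.* 2 ℕ.^ m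
  eNat+2^k+4≡3*2^m {m} {k} k≤m 1≤k =
    trans (cong (ℕ._+ (K ℕ.+ 4)) (ℕₚ.∸-+-assoc (3 ℕ.* N) K 4)) (ℕₚ.m∸n+n≡m K+4≤3N)
    where
    N = 2 ℕ.^ m
    K = 2 ℕ.^ k
    K≤N : K ≤ N
    K≤N = ℕₚ.^-monoʳ-≤ 2 k≤m
    2≤N : 2 ≤ N
    2≤N = ℕₚ.≤-trans (ℕₚ.^-monoʳ-≤ 2 1≤k) K≤N
    K+4≤3N : K ℕ.+ 4 ≤ 3 ℕ.* N
    K+4≤3N = subst (K ℕ.+ 4 ≤_) (cong (λ n → N ℕ.+ (N ℕ.+ n)) (sym (ℕₚ.+-identityʳ N)))
                   (ℕₚ.+-mono-≤ K≤N (ℕₚ.+-mono-≤ 2≤N 2≤N))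

  -- eNat m k = e + 2(2^m - 1), so it has the same inverse d.
  eNat*d≡1 : ∀ {m k d} → k ≤ m → 1 ≤ k → + (2 ℕ.^ m ℕ.∸ 1) ℤ∣.∣ (eℤ m k * + d - + 1)
           → + (2 ℕ.^ m ℕ.∸ 1) ∣ˢ (+ (eNat m k ℕ.* d) - + 1)
  eNat*d≡1 {m} {k} {d} k≤m 1≤k ed≡1 = shift (∣ᵤ⇒∣ ed≡1)
    where
    N = 2 ℕ.^ m
    K = 2 ℕ.^ k
    M = N ℕ.∸ 1
    split : ∀ e M d → (e + + 2 * M) * d - + 1 ≡ (e * d - + 1) + (+ 2 * d) * M
    split = solve-∀
    rearrange : ∀ E K → E ≡ (E + (K + + 4)) - (K + + 4)
    rearrange = solve-∀
    regroup : ∀ N K → (+ 3 * N) - (K + + 4) ≡ (N - K - + 2) + + 2 * (N - + 1)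
    regroup = solve-∀
    +M≡N-1 : + M ≡ + N - + 1
    +M≡N-1 = trans (sym (ℤₚ.⊖-≥ (ℕₚ.m^n>0 2 m))) (sym (ℤₚ.[+m]-[+n]≡m⊖n N 1))
    +eNat≡e+2M : + eNat m k ≡ eℤ m k + + 2 * + M
    +eNat≡e+2M = begin
      + eNat m k                                 ≡⟨ rearrange (+ eNat m k) (+ K) ⟩
      (+ eNat m k + (+ K + + 4)) - (+ K + + 4)   ≡⟨ cong (_- (+ K + + 4)) (trans (sym (ℤₚ.pos-+ (eNat m k) (K ℕ.+ 4)))
                                                                          (trans (cong +_ (eNat+2^k+4≡3*2^m k≤m 1≤k)) (ℤₚ.pos-* 3 N))) ⟩
      (+ 3 * + N) - (+ K + + 4)                  ≡⟨ regroup (+ N) (+ K) ⟩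
      (+ N - + K - + 2) + + 2 * (+ N - + 1)      ≡⟨ cong (λ i → eℤ m k + + 2 * i) (sym +M≡N-1) ⟩
      eℤ m k + + 2 * + M                         ∎
    shift : + M ∣ˢ (eℤ m k * + d - + 1) → + M ∣ˢ (+ (eNat m k ℕ.* d) - + 1)
    shift (divides t ed-1≡tM) = divides (t + + 2 * + d) (begin
      + (eNat m k ℕ.* d) - + 1                         ≡⟨ cong (_- + 1) (ℤₚ.pos-* (eNat m k) d) ⟩
      + eNat m k * + d - + 1                           ≡⟨ cong (λ i → i * + d - + 1) +eNat≡e+2M ⟩
      (eℤ m k + + 2 * + M) * + d - + 1                 ≡⟨ split (eℤ m k) (+ M) (+ d) ⟩
      (eℤ m k * + d - + 1) + (+ 2 * + d) * + M         ≡⟨ cong (λ i → i + (+ 2 * + d) * + M) ed-1≡tM ⟩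
      t * + M + (+ 2 * + d) * + M                      ≡⟨ sym (ℤₚ.*-distribʳ-+ (+ M) t (+ 2 * + d)) ⟩
      (t + + 2 * + d) * + M                            ∎)

module FieldArithmetic {m : ℕ} (F : GF m) where
  open GF F
  open GFOps F
  open IsCommutativeRing isCommutativeRing public
    using (+-assoc; +-comm; +-identityˡ; +-identityʳ; -‿inverseˡ; -‿inverseʳ; zeroˡ; zeroʳ;
           *-assoc; *-comm; *-identityˡ; *-identityʳ; distribˡ; distribʳ;
           +-isCommutativeMonoid; *-isCommutativeMonoid)

  ring : CommutativeRing 0ℓ 0ℓ
  ring = record { isCommutativeRing = isCommutativeRing }

  open CommutativeSemigroupProperties (CommutativeRing.*-commutativeSemigroup ring) public
    using () renaming (interchange to *-interchange; x∙yz≈y∙xz to *-swapˡ)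
  open CommutativeSemigroupProperties (CommutativeRing.+-commutativeSemigroup ring) public
    using () renaming (interchange to +-interchange; x∙yz≈y∙xz to +-swapˡ)
  open GroupProperties (CommutativeRing.+-group ring) public
    using () renaming (∙-cancelˡ to +-cancelˡ)
  open ≡-Reasoning

  inv : ∀ x → x ≢ 0# → Carrier
  inv x x≢0 = proj₁ (inverse x x≢0)

  *-inverseʳ : ∀ x (x≢0 : x ≢ 0#) → x * inv x x≢0 ≡ 1#
  *-inverseʳ x x≢0 = proj₂ (inverse x x≢0)

  *-inverseˡ : ∀ x (x≢0 : x ≢ 0#) → inv x x≢0 * x ≡ 1#
  *-inverseˡ x x≢0 = trans (*-comm _ _) (*-inverseʳ x x≢0)

  *-cancelˡ : ∀ {x y z} → x ≢ 0# → x * y ≡ x * z → y ≡ z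
  *-cancelˡ {x} {y} {z} x≢0 xy≡xz = begin
    y                    ≡⟨ sym (*-identityˡ y) ⟩
    1# * y               ≡⟨ cong (_* y) (sym (*-inverseˡ x x≢0)) ⟩
    (inv x x≢0 * x) * y  ≡⟨ *-assoc _ _ _ ⟩
    inv x x≢0 * (x * y)  ≡⟨ cong (inv x x≢0 *_) xy≡xz ⟩
    inv x x≢0 * (x * z)  ≡⟨ sym (*-assoc _ _ _) ⟩
    (inv x x≢0 * x) * z  ≡⟨ cong (_* z) (*-inverseˡ x x≢0) ⟩
    1# * z               ≡⟨ *-identityˡ z ⟩
    z                    ∎

  x*y≡0⇒x≡0∨y≡0 : ∀ {x y} → x * y ≡ 0# → x ≡ 0# ⊎ y ≡ 0#
  x*y≡0⇒x≡0∨y≡0 {x} {y} xy≡0 with x ≟ 0#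
  ... | yes x≡0 = inj₁ x≡0
  ... | no  x≢0 = inj₂ (*-cancelˡ x≢0 (trans xy≡0 (sym (zeroʳ x))))

  *-≢0 : ∀ {x y} → x ≢ 0# → y ≢ 0# → x * y ≢ 0#
  *-≢0 x≢0 y≢0 xy≡0 with x*y≡0⇒x≡0∨y≡0 xy≡0
  ... | inj₁ x≡0 = x≢0 x≡0
  ... | inj₂ y≡0 = y≢0 y≡0

  inv-unique : ∀ {x y z} → x * y ≡ 1# → x * z ≡ 1# → y ≡ z
  inv-unique {x} xy≡1 xz≡1 =
    *-cancelˡ (λ x≡0 → 0≢1 (trans (sym (zeroˡ _)) (trans (cong (_* _) (sym x≡0)) xy≡1))) (trans xy≡1 (sym xz≡1))

  ^-distribˡ-+-* : ∀ x a b → x ^ⁿ (a ℕ.+ b) ≡ x ^ⁿ a * x ^ⁿ b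
  ^-distribˡ-+-* x zero    b = sym (*-identityˡ _)
  ^-distribˡ-+-* x (suc a) b = trans (cong (x *_) (^-distribˡ-+-* x a b)) (sym (*-assoc _ _ _))

  ^-distribʳ-* : ∀ x y n → (x * y) ^ⁿ n ≡ x ^ⁿ n * y ^ⁿ n
  ^-distribʳ-* x y zero    = sym (*-identityˡ 1#)
  ^-distribʳ-* x y (suc n) = trans (cong ((x * y) *_) (^-distribʳ-* x y n)) (*-interchange _ _ _ _)

  ^-*-assoc : ∀ x a b → (x ^ⁿ a) ^ⁿ b ≡ x ^ⁿ (a ℕ.* b)
  ^-*-assoc x a zero    = cong (x ^ⁿ_) (sym (ℕₚ.*-zeroʳ a))
  ^-*-assoc x a (suc b) = begin
    x ^ⁿ a * (x ^ⁿ a) ^ⁿ b    ≡⟨ cong (x ^ⁿ a *_) (^-*-assoc x a b) ⟩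
    x ^ⁿ a * x ^ⁿ (a ℕ.* b)   ≡⟨ sym (^-distribˡ-+-* x a (a ℕ.* b)) ⟩
    x ^ⁿ (a ℕ.+ a ℕ.* b)      ≡⟨ cong (x ^ⁿ_) (sym (ℕₚ.*-suc a b)) ⟩
    x ^ⁿ (a ℕ.* suc b)        ∎

  ^-comm : ∀ x a b → (x ^ⁿ a) ^ⁿ b ≡ (x ^ⁿ b) ^ⁿ a
  ^-comm x a b = trans (^-*-assoc x a b) (trans (cong (x ^ⁿ_) (ℕₚ.*-comm a b)) (sym (^-*-assoc x b a)))

  1^n≡1 : ∀ n → 1# ^ⁿ n ≡ 1#
  1^n≡1 zero    = refl
  1^n≡1 (suc n) = trans (*-identityˡ _) (1^n≡1 n)

  ^-≢0 : ∀ {x} n → x ≢ 0# → x ^ⁿ n ≢ 0#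
  ^-≢0 zero    x≢0 1≡0 = 0≢1 (sym 1≡0)
  ^-≢0 (suc n) x≢0     = *-≢0 x≢0 (^-≢0 n x≢0)

  2^n≡1+[2^n∸1] : ∀ n → 2 ℕ.^ n ≡ suc (2 ℕ.^ n ℕ.∸ 1)
  2^n≡1+[2^n∸1] n = sym (ℕₚ.m+[n∸m]≡n (ℕₚ.m^n>0 2 n))

  0^2^j≡0 : ∀ j → 0# ^ⁿ (2 ℕ.^ j) ≡ 0#
  0^2^j≡0 j = trans (cong (0# ^ⁿ_) (2^n≡1+[2^n∸1] j)) (zeroˡ _)

  1≤m : 1 ≤ m
  1≤m = ℕₚ.n≢0⇒n>0 (λ m≡0 → two-elements elems (elems-complete 0#) (elems-complete 1#) (trans card (cong (2 ℕ.^_) m≡0)))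
    where
    two-elements : ∀ xs → 0# ∈ xs → 1# ∈ xs → length xs ≢ 1
    two-elements (a ∷ [])     (here 0≡a) (here 1≡a) _ = 0≢1 (trans 0≡a (sym 1≡a))
    two-elements (a ∷ [])     (here _)   (there ()) _
    two-elements (a ∷ [])     (there ()) _          _
    two-elements (a ∷ b ∷ xs) _          _          ()

  fromℕ : ℕ → Carrier
  fromℕ zero    = 0#
  fromℕ (suc n) = 1# + fromℕ n

  fromℕ-+ : ∀ a b → fromℕ (a ℕ.+ b) ≡ fromℕ a + fromℕ b
  fromℕ-+ zero    b = sym (+-identityˡ _)
  fromℕ-+ (suc a) b = trans (cong (1# +_) (fromℕ-+ a b)) (sym (+-assoc _ _ _))

  fromℕ-* : ∀ a b → fromℕ (a ℕ.* b) ≡ fromℕ a * fromℕ b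
  fromℕ-* zero    b = sym (zeroˡ _)
  fromℕ-* (suc a) b = begin
    fromℕ (b ℕ.+ a ℕ.* b)            ≡⟨ fromℕ-+ b (a ℕ.* b) ⟩
    fromℕ b + fromℕ (a ℕ.* b)        ≡⟨ cong₂ _+_ (sym (*-identityˡ _)) (fromℕ-* a b) ⟩
    1# * fromℕ b + fromℕ a * fromℕ b ≡⟨ sym (distribʳ _ _ _) ⟩
    (1# + fromℕ a) * fromℕ b         ∎

  fromℕ-^ : ∀ a n → fromℕ (a ℕ.^ n) ≡ fromℕ a ^ⁿ n
  fromℕ-^ a zero    = +-identityʳ 1#
  fromℕ-^ a (suc n) = trans (fromℕ-* a (a ℕ.^ n)) (cong (fromℕ a *_) (fromℕ-^ a n))

  module Σᶠ = ListFold _≟_ +-isCommutativeMonoid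

  Σᶠ-const : ∀ xs c → Σᶠ.fold xs (λ _ → c) ≡ fromℕ (length xs) * c
  Σᶠ-const []       c = sym (zeroˡ c)
  Σᶠ-const (x ∷ xs) c = begin
    c + Σᶠ.fold xs (λ _ → c)          ≡⟨ cong₂ _+_ (sym (*-identityˡ c)) (Σᶠ-const xs c) ⟩
    1# * c + fromℕ (length xs) * c    ≡⟨ sym (distribʳ _ _ _) ⟩
    (1# + fromℕ (length xs)) * c      ∎

  -- Translating by 1 permutes the field, so Σ (x + 1) = Σ x forces |F| · 1 = 0.
  characteristic-2 : 1# + 1# ≡ 0#
  characteristic-2 = ^≡0 m (begin
    (1# + 1#) ^ⁿ m           ≡⟨ cong (_^ⁿ m) (cong (1# +_) (sym (+-identityʳ 1#))) ⟩
    fromℕ 2 ^ⁿ m             ≡⟨ sym (fromℕ-^ 2 m) ⟩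
    fromℕ (2 ℕ.^ m)          ≡⟨ cong fromℕ (sym card) ⟩
    fromℕ (length elems)     ≡⟨ |F|·1≡0 ⟩
    0#                       ∎)
    where
    ^≡0 : ∀ {x} n → x ^ⁿ n ≡ 0# → x ≡ 0#
    ^≡0 zero    1≡0 = ⊥-elim (0≢1 (sym 1≡0))
    ^≡0 (suc n) xxⁿ≡0 with x*y≡0⇒x≡0∨y≡0 xxⁿ≡0
    ... | inj₁ x≡0  = x≡0
    ... | inj₂ xⁿ≡0 = ^≡0 n xⁿ≡0
    Σx : Carrier
    Σx = Σᶠ.fold elems (λ x → x)
    |F|·1≡0 : fromℕ (length elems) ≡ 0#
    |F|·1≡0 = +-cancelˡ _ _ _ (begin
      Σx + fromℕ (length elems)              ≡⟨ cong (Σx +_) (sym (trans (Σᶠ-const elems 1#) (*-identityʳ _))) ⟩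
      Σx + Σᶠ.fold elems (λ _ → 1#)          ≡⟨ sym (Σᶠ.fold-⊕ elems (λ x → x) (λ _ → 1#)) ⟩
      Σᶠ.fold elems (λ x → x + 1#)           ≡⟨ Σᶠ.fold-reindex elems-unique elems-complete (_+ 1#) (_+ - 1#)
                                                  (λ x → +-cancelsʳ x (-‿inverseˡ 1#)) (λ x → +-cancelsʳ x (-‿inverseʳ 1#)) (λ x → x) ⟩
      Σx                                     ≡⟨ sym (+-identityʳ _) ⟩
      Σx + 0#                                ∎)
      where
      +-cancelsʳ : ∀ x {a b} → a + b ≡ 0# → (x + a) + b ≡ x
      +-cancelsʳ x a+b≡0 = trans (+-assoc _ _ _) (trans (cong (x +_) a+b≡0) (+-identityʳ x))

  x+x≡0 : ∀ x → x + x ≡ 0#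
  x+x≡0 x = begin
    x + x              ≡⟨ cong₂ _+_ (sym (*-identityˡ x)) (sym (*-identityˡ x)) ⟩
    1# * x + 1# * x    ≡⟨ sym (distribʳ _ _ _) ⟩
    (1# + 1#) * x      ≡⟨ cong (_* x) characteristic-2 ⟩
    0# * x             ≡⟨ zeroˡ x ⟩
    0#                 ∎

  x≡a+[x+a] : ∀ x a → x ≡ a + (x + a)
  x≡a+[x+a] x a = sym (trans (+-swapˡ a x a) (trans (cong (x +_) (x+x≡0 a)) (+-identityʳ x)))

  x+y≡0⇒x≡y : ∀ {x y} → x + y ≡ 0# → x ≡ y
  x+y≡0⇒x≡y {x} {y} x+y≡0 = +-cancelˡ _ _ _ (trans (+-comm y x) (trans x+y≡0 (sym (x+x≡0 y))))

  fromℕ-odd : ∀ r → fromℕ (suc (2 ℕ.* r)) ≡ 1#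
  fromℕ-odd r = begin
    1# + fromℕ (2 ℕ.* r)             ≡⟨ cong (1# +_) (fromℕ-* 2 r) ⟩
    1# + (1# + (1# + 0#)) * fromℕ r  ≡⟨ cong (λ t → 1# + (1# + t) * fromℕ r) (+-identityʳ 1#) ⟩
    1# + (1# + 1#) * fromℕ r         ≡⟨ cong (λ t → 1# + t * fromℕ r) characteristic-2 ⟩
    1# + 0# * fromℕ r                ≡⟨ cong (1# +_) (zeroˡ _) ⟩
    1# + 0#                          ≡⟨ +-identityʳ 1# ⟩
    1#                               ∎

  nonzero : List Carrier
  nonzero = filter (λ x → ¬? (x ≟ 0#)) elems

  nonzero-unique : Unique nonzero
  nonzero-unique = Unique.filter⁺ _ elems-unique

  ∈-nonzero⁺ : ∀ {x} → x ≢ 0# → x ∈ nonzero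
  ∈-nonzero⁺ {x} x≢0 = ∈-filter⁺ (λ x → ¬? (x ≟ 0#)) (elems-complete x) x≢0

  ∈-nonzero⁻ : ∀ {x} → x ∈ nonzero → x ≢ 0#
  ∈-nonzero⁻ x∈ = proj₂ (∈-filter⁻ (λ x → ¬? (x ≟ 0#)) {xs = elems} x∈)

  length-nonzero : length nonzero ≡ 2 ℕ.^ m ℕ.∸ 1
  length-nonzero = begin
    length nonzero                    ≡⟨ sym (count nonzero) ⟩
    fold nonzero (λ _ → 1)            ≡⟨ sym (ℕₚ.m+n∸m≡n 1 _) ⟩
    suc (fold nonzero (λ _ → 1)) ℕ.∸ 1  ≡⟨ cong (ℕ._∸ 1) (sym (fold-remove (λ _ → 1) elems-unique (elems-complete 0#))) ⟩
    fold elems (λ _ → 1) ℕ.∸ 1        ≡⟨ cong (ℕ._∸ 1) (trans (count elems) card) ⟩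
    2 ℕ.^ m ℕ.∸ 1                     ∎
    where
    open ListFold _≟_ ℕₚ.+-0-isCommutativeMonoid using (fold; fold-remove)
    count : ∀ xs → fold xs (λ _ → 1) ≡ length xs
    count []       = refl
    count (x ∷ xs) = cong suc (count xs)

  -- Multiplying by a ≠ 0 permutes the nonzero elements, so a^(2^m - 1) · Π x = Π x.
  fermat : ∀ {a} → a ≢ 0# → a ^ⁿ (2 ℕ.^ m ℕ.∸ 1) ≡ 1#
  fermat {a} a≢0 = *-cancelˡ Π≢0 (begin
    Π * a ^ⁿ (2 ℕ.^ m ℕ.∸ 1)             ≡⟨ *-comm _ _ ⟩
    a ^ⁿ (2 ℕ.^ m ℕ.∸ 1) * Π             ≡⟨ cong (λ n → a ^ⁿ n * Π) (sym length-nonzero) ⟩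
    a ^ⁿ length nonzero * Π              ≡⟨ sym (Π-scale nonzero) ⟩
    fold nonzero (a *_)                  ≡⟨ sym (fold-map nonzero (a *_) (λ x → x)) ⟩
    fold (map (a *_) nonzero) (λ x → x)  ≡⟨ fold-sameElements (λ x → x) (Unique.map⁺ (*-cancelˡ a≢0) nonzero-unique)
                                              nonzero-unique aN⊆N N⊆aN ⟩
    Π                                    ≡⟨ sym (*-identityʳ Π) ⟩
    Π * 1#                               ∎)
    where
    open ListFold _≟_ *-isCommutativeMonoid using (fold; fold-map; fold-sameElements)
    Π = fold nonzero (λ x → x)
    Π≢0 : Π ≢ 0#
    Π≢0 = Π-≢0 nonzero (All.tabulate ∈-nonzero⁻)
      where
      Π-≢0 : ∀ xs → All (_≢ 0#) xs → fold xs (λ x → x) ≢ 0#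
      Π-≢0 []       []          1≡0 = 0≢1 (sym 1≡0)
      Π-≢0 (x ∷ xs) (x≢0 ∷ xs≢0)     = *-≢0 x≢0 (Π-≢0 xs xs≢0)
    Π-scale : ∀ xs → fold xs (a *_) ≡ a ^ⁿ length xs * fold xs (λ x → x)
    Π-scale []       = sym (*-identityˡ 1#)
    Π-scale (x ∷ xs) = trans (cong ((a * x) *_) (Π-scale xs)) (*-interchange _ _ _ _)
    aN⊆N : ∀ z → z ∈ map (a *_) nonzero → z ∈ nonzero
    aN⊆N z z∈ with ∈-map⁻ (a *_) z∈
    ... | x , x∈ , refl = ∈-nonzero⁺ (*-≢0 a≢0 (∈-nonzero⁻ x∈))
    N⊆aN : ∀ z → z ∈ nonzero → z ∈ map (a *_) nonzero
    N⊆aN z z∈ = subst (_∈ map (a *_) nonzero) a[a⁻¹z]≡z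
      (∈-map⁺ (a *_) (∈-nonzero⁺ (*-≢0 (λ a⁻¹≡0 → 0≢1 (trans (sym (zeroʳ a)) (trans (cong (a *_) (sym a⁻¹≡0)) (*-inverseʳ a a≢0))))
                                        (∈-nonzero⁻ z∈))))
      where
      a[a⁻¹z]≡z : a * (inv a a≢0 * z) ≡ z
      a[a⁻¹z]≡z = trans (sym (*-assoc _ _ _)) (trans (cong (_* z) (*-inverseʳ a a≢0)) (*-identityˡ z))

  x^2^m≡x : ∀ x → x ^ⁿ (2 ℕ.^ m) ≡ x
  x^2^m≡x x with x ≟ 0#
  ... | yes refl = 0^2^j≡0 m
  ... | no  x≢0  = trans (cong (x ^ⁿ_) (2^n≡1+[2^n∸1] m)) (trans (cong (x *_) (fermat x≢0)) (*-identityʳ x))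

  infix 8 _²
  _² : Carrier → Carrier
  x ² = x * x

  pw-≢0 : ∀ {x} n → x ≢ 0# → pw x n ≡ x ^ⁿ n
  pw-≢0 {x} n x≢0 with x ≟ 0#
  ... | yes x≡0 = ⊥-elim (x≢0 x≡0)
  ... | no  _   = refl

  pw-≢0⇒≢0 : ∀ {x} n → x ≢ 0# → pw x n ≢ 0#
  pw-≢0⇒≢0 n x≢0 pw≡0 = ^-≢0 n x≢0 (trans (sym (pw-≢0 n x≢0)) pw≡0)

  x^2≡x² : ∀ x → x ^ⁿ 2 ≡ x ²
  x^2≡x² x = cong (x *_) (*-identityʳ x)

  pw-2 : ∀ x → pw x 2 ≡ x ²
  pw-2 x with x ≟ 0#
  ... | yes refl = sym (zeroˡ 0#)
  ... | no  _    = x^2≡x² x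

  ²-+ : ∀ x y → (x + y) ² ≡ x ² + y ²
  ²-+ x y = begin
    (x + y) * (x + y)                 ≡⟨ distribʳ _ _ _ ⟩
    x * (x + y) + y * (x + y)         ≡⟨ cong₂ _+_ (distribˡ _ _ _) (distribˡ _ _ _) ⟩
    (x * x + x * y) + (y * x + y * y) ≡⟨ +-interchange _ _ _ _ ⟩
    (x * x + y * x) + (x * y + y * y) ≡⟨ cong (λ t → (x * x + t) + (x * y + y * y)) (*-comm y x) ⟩
    (x * x + x * y) + (x * y + y * y) ≡⟨ +-assoc _ _ _ ⟩
    x * x + (x * y + (x * y + y * y)) ≡⟨ cong (x * x +_) (sym (+-assoc _ _ _)) ⟩
    x * x + ((x * y + x * y) + y * y) ≡⟨ cong (λ t → x * x + (t + y * y)) (x+x≡0 _) ⟩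
    x * x + (0# + y * y)              ≡⟨ cong (x * x +_) (+-identityˡ _) ⟩
    x * x + y * y                     ∎

  ²-* : ∀ x y → (x * y) ² ≡ x ² * y ²
  ²-* x y = *-interchange x y x y

  ²-≢0 : ∀ {x} → x ≢ 0# → x ² ≢ 0#
  ²-≢0 x≢0 = *-≢0 x≢0 x≢0

  x^2^[1+j]≡[x^2^j]² : ∀ x j → x ^ⁿ (2 ℕ.^ suc j) ≡ (x ^ⁿ (2 ℕ.^ j)) ²
  x^2^[1+j]≡[x^2^j]² x j =
    trans (cong (x ^ⁿ_) (ℕₚ.*-comm 2 (2 ℕ.^ j))) (trans (sym (^-*-assoc x (2 ℕ.^ j) 2)) (x^2≡x² _))

  frobenius-+ : ∀ x y j → (x + y) ^ⁿ (2 ℕ.^ j) ≡ x ^ⁿ (2 ℕ.^ j) + y ^ⁿ (2 ℕ.^ j)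
  frobenius-+ x y zero    = trans (*-identityʳ _) (cong₂ _+_ (sym (*-identityʳ x)) (sym (*-identityʳ y)))
  frobenius-+ x y (suc j) = begin
    (x + y) ^ⁿ (2 ℕ.^ suc j)                        ≡⟨ x^2^[1+j]≡[x^2^j]² (x + y) j ⟩
    ((x + y) ^ⁿ (2 ℕ.^ j)) ²                        ≡⟨ cong _² (frobenius-+ x y j) ⟩
    (x ^ⁿ (2 ℕ.^ j) + y ^ⁿ (2 ℕ.^ j)) ²             ≡⟨ ²-+ _ _ ⟩
    (x ^ⁿ (2 ℕ.^ j)) ² + (y ^ⁿ (2 ℕ.^ j)) ²         ≡⟨ cong₂ _+_ (sym (x^2^[1+j]≡[x^2^j]² x j)) (sym (x^2^[1+j]≡[x^2^j]² y j)) ⟩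
    x ^ⁿ (2 ℕ.^ suc j) + y ^ⁿ (2 ℕ.^ suc j)         ∎

  √ : Carrier → Carrier
  √ x = x ^ⁿ (2 ℕ.^ (m ℕ.∸ 1))

  [x^a]^b≡x : ∀ x a b → a ℕ.* b ≡ 2 ℕ.^ m → (x ^ⁿ a) ^ⁿ b ≡ x
  [x^a]^b≡x x a b ab≡2^m = trans (^-*-assoc x a b) (trans (cong (x ^ⁿ_) ab≡2^m) (x^2^m≡x x))

  √-² : ∀ x → (√ x) ² ≡ x
  √-² x = trans (sym (x^2≡x² (√ x)))
    ([x^a]^b≡x x (2 ℕ.^ (m ℕ.∸ 1)) 2 (trans (ℕₚ.*-comm (2 ℕ.^ (m ℕ.∸ 1)) 2) (cong (2 ℕ.^_) (ℕₚ.m+[n∸m]≡n 1≤m))))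

  ²-√ : ∀ x → √ (x ²) ≡ x
  ²-√ x = trans (cong √ (sym (x^2≡x² x))) ([x^a]^b≡x x 2 (2 ℕ.^ (m ℕ.∸ 1)) (cong (2 ℕ.^_) (ℕₚ.m+[n∸m]≡n 1≤m)))

  Σ<-cong : ∀ n {f g : ℕ → Carrier} → (∀ i → f i ≡ g i) → Σ< n f ≡ Σ< n g
  Σ<-cong zero    f≗g = refl
  Σ<-cong (suc n) f≗g = cong₂ _+_ (Σ<-cong n f≗g) (f≗g n)

  Σ<-+ : ∀ n (f g : ℕ → Carrier) → Σ< n (λ i → f i + g i) ≡ Σ< n f + Σ< n g
  Σ<-+ zero    f g = sym (+-identityˡ 0#)
  Σ<-+ (suc n) f g = trans (cong (_+ (f n + g n)) (Σ<-+ n f g)) (+-interchange _ _ _ _)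

  Σ<-const : ∀ n c → Σ< n (λ _ → c) ≡ fromℕ n * c
  Σ<-const zero    c = sym (zeroˡ c)
  Σ<-const (suc n) c = begin
    Σ< n (λ _ → c) + c        ≡⟨ cong₂ _+_ (Σ<-const n c) (sym (*-identityˡ c)) ⟩
    fromℕ n * c + 1# * c      ≡⟨ sym (distribʳ _ _ _) ⟩
    (fromℕ n + 1#) * c        ≡⟨ cong (_* c) (+-comm _ _) ⟩
    (1# + fromℕ n) * c        ∎

  Σ<-odd-const : ∀ r c → Σ< (suc (2 ℕ.* r)) (λ _ → c) ≡ c
  Σ<-odd-const r c = trans (Σ<-const (suc (2 ℕ.* r)) c) (trans (cong (_* c) (fromℕ-odd r)) (*-identityˡ c))

  Σ<-*ˡ : ∀ n c (f : ℕ → Carrier) → c * Σ< n f ≡ Σ< n (λ i → c * f i)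
  Σ<-*ˡ zero    c f = zeroʳ c
  Σ<-*ˡ (suc n) c f = trans (distribˡ _ _ _) (cong (_+ c * f n) (Σ<-*ˡ n c f))

  Σ<-hom : ∀ n (f : ℕ → Carrier) (φ : Carrier → Carrier) → φ 0# ≡ 0# → (∀ a b → φ (a + b) ≡ φ a + φ b)
         → φ (Σ< n f) ≡ Σ< n (φ ∘ f)
  Σ<-hom zero    f φ φ0 φ+ = φ0
  Σ<-hom (suc n) f φ φ0 φ+ = trans (φ+ _ _) (cong (_+ φ (f n)) (Σ<-hom n f φ φ0 φ+))

  Σ<-rotate : ∀ n (f : ℕ → Carrier) → f n ≡ f 0 → Σ< n (f ∘ suc) ≡ Σ< n f
  Σ<-rotate n f fn≡f0 = +-cancelˡ _ _ _ (begin
    f 0 + Σ< n (f ∘ suc)  ≡⟨ sym (Σ<-unroll n) ⟩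
    Σ< n f + f n          ≡⟨ cong (Σ< n f +_) fn≡f0 ⟩
    Σ< n f + f 0          ≡⟨ +-comm _ _ ⟩
    f 0 + Σ< n f          ∎)
    where
    Σ<-unroll : ∀ n → Σ< (suc n) f ≡ f 0 + Σ< n (f ∘ suc)
    Σ<-unroll zero    = trans (+-identityˡ _) (sym (+-identityʳ _))
    Σ<-unroll (suc n) = trans (cong (_+ f (suc n)) (Σ<-unroll n)) (+-assoc _ _ _)

  frobenius-Σ< : ∀ n f j → (Σ< n f) ^ⁿ (2 ℕ.^ j) ≡ Σ< n (λ i → f i ^ⁿ (2 ℕ.^ j))
  frobenius-Σ< n f j = Σ<-hom n f (_^ⁿ (2 ℕ.^ j)) (0^2^j≡0 j) (λ a b → frobenius-+ a b j)

  Tr-+ : ∀ x y → Tr (x + y) ≡ Tr x + Tr y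
  Tr-+ x y = trans (Σ<-cong m (frobenius-+ x y)) (Σ<-+ m _ _)

  Tr-0 : Tr 0# ≡ 0#
  Tr-0 = trans (Σ<-cong m 0^2^j≡0) (trans (Σ<-const m 0#) (zeroʳ _))

  Tr-² : ∀ x → Tr (x ²) ≡ Tr x
  Tr-² x = begin
    Σ< m (λ i → (x ²) ^ⁿ (2 ℕ.^ i))     ≡⟨ Σ<-cong m (λ i → trans (cong (_^ⁿ (2 ℕ.^ i)) (sym (x^2≡x² x))) (^-*-assoc x 2 (2 ℕ.^ i))) ⟩
    Σ< m (λ i → x ^ⁿ (2 ℕ.^ suc i))     ≡⟨ Σ<-rotate m (λ i → x ^ⁿ (2 ℕ.^ i)) (trans (x^2^m≡x x) (sym (*-identityʳ x))) ⟩
    Tr x                                ∎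

  [Tr]²≡Tr[²] : ∀ x → (Tr x) ² ≡ Tr (x ²)
  [Tr]²≡Tr[²] x = trans (Σ<-hom m _ _² (zeroˡ 0#) ²-+)
    (Σ<-cong m (λ i → trans (sym (x^2^[1+j]≡[x^2^j]² x i))
                     (trans (sym (^-*-assoc x 2 (2 ℕ.^ i))) (cong (_^ⁿ (2 ℕ.^ i)) (x^2≡x² x)))))

  Bit : Carrier → Set
  Bit t = t ≡ 0# ⊎ t ≡ 1#

  Tr-bit : ∀ x → Bit (Tr x)
  Tr-bit x with Tr x ≟ 0#
  ... | yes Tr≡0 = inj₁ Tr≡0
  ... | no  Tr≢0 = inj₂ (*-cancelˡ Tr≢0 (trans (trans ([Tr]²≡Tr[²] x) (Tr-² x)) (sym (*-identityʳ _))))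

  Tr-frobenius : ∀ x j → Tr (x ^ⁿ (2 ℕ.^ j)) ≡ Tr x
  Tr-frobenius x zero    = cong Tr (*-identityʳ x)
  Tr-frobenius x (suc j) = trans (cong Tr (x^2^[1+j]≡[x^2^j]² x j)) (trans (Tr-² _) (Tr-frobenius x j))

module PolynomialRoots {m : ℕ} (F : GF m) where
  open GF F
  open GFOps F
  open FieldArithmetic F
  open RingSolver (fromCommutativeRing ring (λ _ → nothing)) using (solve; _⊜_; _⊕_; _⊗_; Κ)
  open ≡-Reasoning

  -- Horner forms: horner cs has degree < n, and monic cs = x^n + horner cs has an implicit leading 1.
  horner : ∀ {n} → Vec Carrier n → Carrier → Carrier
  horner []       x = 0#
  horner (c ∷ cs) x = c + x * horner cs x

  monic : ∀ {n} → Vec Carrier n → Carrier → Carrier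
  monic []       x = 1#
  monic (c ∷ cs) x = c + x * monic cs x

  monic≡x^n+horner : ∀ {n} (cs : Vec Carrier n) x → monic cs x ≡ x ^ⁿ n + horner cs x
  monic≡x^n+horner []               x = sym (+-identityʳ 1#)
  monic≡x^n+horner {suc n} (c ∷ cs) x = trans (cong (λ t → c + x * t) (monic≡x^n+horner cs x))
    (solve 4 (λ c x xⁿ h → (c ⊕ x ⊗ (xⁿ ⊕ h)) ⊜ (x ⊗ xⁿ ⊕ (c ⊕ x ⊗ h))) refl c x (x ^ⁿ n) (horner cs x))

  divide : ∀ {n} → Carrier → Vec Carrier (suc n) → Vec Carrier n
  divide a (c ∷ [])      = []
  divide a (c ∷ c' ∷ cs) = monic (c' ∷ cs) a ∷ divide a (c' ∷ cs)

  -- Char 2: x - a = x + a.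
  factor-theorem : ∀ {n} a (p : Vec Carrier (suc n)) x → monic p x ≡ monic p a + (x + a) * monic (divide a p) x
  factor-theorem a (c ∷ []) x = begin
    c + x * 1#                     ≡⟨ cong (λ t → c + t * 1#) (x≡a+[x+a] x a) ⟩
    c + (a + (x + a)) * 1#         ≡⟨ solve 3 (λ c a d → (c ⊕ (a ⊕ d) ⊗ Κ 1#) ⊜ ((c ⊕ a ⊗ Κ 1#) ⊕ d ⊗ Κ 1#)) refl c a (x + a) ⟩
    (c + a * 1#) + (x + a) * 1#    ∎
  factor-theorem a (c ∷ c' ∷ cs) x = begin
    c + x * monic (c' ∷ cs) x         ≡⟨ cong₂ (λ s t → c + s * t) (x≡a+[x+a] x a) (factor-theorem a (c' ∷ cs) x) ⟩
    c + (a + d) * (pa + d * qx)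
      ≡⟨ solve 5 (λ c a d pa qx → (c ⊕ (a ⊕ d) ⊗ (pa ⊕ d ⊗ qx)) ⊜ ((c ⊕ a ⊗ pa) ⊕ d ⊗ (pa ⊕ (a ⊕ d) ⊗ qx))) refl c a d pa qx ⟩
    (c + a * pa) + d * (pa + (a + d) * qx) ≡⟨ cong (λ t → (c + a * pa) + d * (pa + t * qx)) (sym (x≡a+[x+a] x a)) ⟩
    (c + a * pa) + d * (pa + x * qx)  ∎
    where
    d  = x + a
    pa = monic (c' ∷ cs) a
    qx = monic (divide a (c' ∷ cs)) x

  LowDegree : ℕ → (Carrier → Carrier) → Set
  LowDegree n g = ∃ λ (cs : Vec Carrier n) → ∀ x → g x ≡ horner cs x

  IsMonic : ℕ → (Carrier → Carrier) → Set
  IsMonic n f = ∃ λ (cs : Vec Carrier n) → ∀ x → f x ≡ monic cs x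

  lowDegree-0 : ∀ n → LowDegree n (λ _ → 0#)
  lowDegree-0 zero    = [] , λ _ → refl
  lowDegree-0 (suc n) with lowDegree-0 n
  ... | cs , 0≡h = (0# ∷ cs) , λ x → sym (trans (cong (λ t → 0# + x * t) (sym (0≡h x))) (trans (+-identityˡ _) (zeroʳ x)))

  lowDegree-^ : ∀ {n} j → j < n → LowDegree n (_^ⁿ j)
  lowDegree-^ {suc n} zero    _ with lowDegree-0 n
  ... | cs , 0≡h = (1# ∷ cs) , λ x → sym (trans (cong (λ t → 1# + x * t) (sym (0≡h x))) (trans (cong (1# +_) (zeroʳ x)) (+-identityʳ 1#)))
  lowDegree-^ {suc n} (suc j) (s≤s j<n) with lowDegree-^ j j<n
  ... | cs , xʲ≡h = (0# ∷ cs) , λ x → sym (trans (cong (λ t → 0# + x * t) (sym (xʲ≡h x))) (+-identityˡ _))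

  lowDegree-+ : ∀ {n g h} → LowDegree n g → LowDegree n h → LowDegree n (λ x → g x + h x)
  lowDegree-+ (cs , g≡) (ds , h≡) = zipAdd cs ds , λ x → trans (cong₂ _+_ (g≡ x) (h≡ x)) (sym (horner-zipAdd cs ds x))
    where
    zipAdd : ∀ {n} → Vec Carrier n → Vec Carrier n → Vec Carrier n
    zipAdd []       []       = []
    zipAdd (a ∷ as) (b ∷ bs) = (a + b) ∷ zipAdd as bs
    horner-zipAdd : ∀ {n} (as bs : Vec Carrier n) x → horner (zipAdd as bs) x ≡ horner as x + horner bs x
    horner-zipAdd []       []       x = sym (+-identityˡ 0#)
    horner-zipAdd (a ∷ as) (b ∷ bs) x = trans (cong (λ t → (a + b) + x * t) (horner-zipAdd as bs x))
      (solve 5 (λ a b x g h → ((a ⊕ b) ⊕ x ⊗ (g ⊕ h)) ⊜ ((a ⊕ x ⊗ g) ⊕ (b ⊕ x ⊗ h))) refl a b x (horner as x) (horner bs x))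

  lowDegree-Σ< : ∀ {n} q (e : ℕ → ℕ) → (∀ i → i < q → e i < n) → LowDegree n (λ x → Σ< q (λ i → x ^ⁿ e i))
  lowDegree-Σ< {n} zero    e e< = lowDegree-0 n
  lowDegree-Σ< {n} (suc q) e e< =
    lowDegree-+ (lowDegree-Σ< q e (λ i i<q → e< i (ℕₚ.m≤n⇒m≤1+n i<q))) (lowDegree-^ (e q) (e< q ℕₚ.≤-refl))

  isMonic : ∀ {n g} → LowDegree n g → IsMonic n (λ x → x ^ⁿ n + g x)
  isMonic {n} (cs , g≡) = cs , λ x → trans (cong (x ^ⁿ n +_) (g≡ x)) (sym (monic≡x^n+horner cs x))

  roots-≤ : ∀ {n f} → IsMonic n f → {P : Carrier → Set} (P? : ∀ x → Dec (P x))
          → (∀ x → P x → f x ≡ 0#) → length (filter P? elems) ≤ n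
  roots-≤ (cs , f≡) P? roots = go cs P? elems-unique (All.universal (λ x Px → trans (sym (f≡ x)) (roots x Px)) elems)
    where
    go : ∀ {n} (p : Vec Carrier n) {P : Carrier → Set} (P? : ∀ x → Dec (P x)) {xs}
       → Unique xs → All (λ x → P x → monic p x ≡ 0#) xs → length (filter P? xs) ≤ n
    go p P? {[]} _ _ = z≤n
    go p {P} P? {a ∷ xs} (a∉xs ∷ uniq) (root-a ∷ roots) with P? a
    ... | no _   = go p P? uniq roots
    ... | yes Pa with p
    ...   | []      = ⊥-elim (0≢1 (sym (root-a Pa)))
    ...   | c ∷ cs' = s≤s (go (divide a (c ∷ cs')) P? uniq (All.zipWith quotient-root (a∉xs , roots)))
      where
      quotient-root : ∀ {x} → a ≢ x × (P x → monic (c ∷ cs') x ≡ 0#) → P x → monic (divide a (c ∷ cs')) x ≡ 0#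
      quotient-root {x} (a≢x , root-x) Px
        with x*y≡0⇒x≡0∨y≡0 (trans (sym (+-identityˡ _)) (trans (cong (_+ (x + a) * monic (divide a (c ∷ cs')) x) (sym (root-a Pa)))
                                 (trans (sym (factor-theorem a (c ∷ cs') x)) (root-x Px))))
      ... | inj₁ x+a≡0 = ⊥-elim (a≢x (sym (x+y≡0⇒x≡y x+a≡0)))
      ... | inj₂ q≡0   = q≡0

  Σ<-powers-isMonic : ∀ q (e : ℕ → ℕ) → (∀ i → i < q → e i < e q) → IsMonic (e q) (λ x → Σ< (suc q) (λ i → x ^ⁿ e i))
  Σ<-powers-isMonic q e e< with isMonic (lowDegree-Σ< q e e<)
  ... | cs , f≡ = cs , λ x → trans (+-comm _ _) (f≡ x)

  RelTr-isMonic : ∀ {k} → 1 ≤ k → ∀ q → IsMonic (2 ℕ.^ (k ℕ.* q)) (RelTr k (suc q))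
  RelTr-isMonic {k} 1≤k q =
    Σ<-powers-isMonic q (λ i → 2 ℕ.^ (k ℕ.* i)) (λ i i<q → ℕₚ.^-monoʳ-< 2 (s≤s (s≤s z≤n)) (ℕₚ.*-monoʳ-< k i<q))
    where instance _ = ℕ.>-nonZero 1≤k

  x^2^k+x-isMonic : ∀ {k} → 1 ≤ k → IsMonic (2 ℕ.^ k) (λ x → x ^ⁿ (2 ℕ.^ k) + x)
  x^2^k+x-isMonic {k} 1≤k with isMonic (lowDegree-^ 1 (ℕₚ.^-monoʳ-< 2 (s≤s (s≤s z≤n)) 1≤k))
  ... | cs , f≡ = cs , λ x → trans (cong (x ^ⁿ (2 ℕ.^ k) +_) (sym (*-identityʳ x))) (f≡ x)

  -- Otherwise all 2^m elements would be roots of Tr, a monic polynomial of degree 2^(m-1).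
  Tr-surjective : ∃ λ t → Tr t ≡ 1#
  Tr-surjective with any? (λ x → Tr x ≟ 1#) elems
  ... | yes ∃Tr≡1 = satisfied ∃Tr≡1
  ... | no  ∄Tr≡1 = contradiction (ℕₚ.≤-trans 2^m≤ (roots-≤ Tr-isMonic (λ _ → yes tt) Tr≡0)) (ℕₚ.<⇒≱ 2^[m-1]<2^m)
    where
    m' = m ℕ.∸ 1
    1+m'≡m : suc m' ≡ m
    1+m'≡m = ℕₚ.m+[n∸m]≡n 1≤m
    Tr-isMonic : IsMonic (2 ℕ.^ m') Tr
    Tr-isMonic with Σ<-powers-isMonic m' (2 ℕ.^_) (λ i → ℕₚ.^-monoʳ-< 2 (s≤s (s≤s z≤n)))
    ... | cs , f≡ = cs , λ x → trans (cong (λ n → Σ< n (λ i → x ^ⁿ (2 ℕ.^ i))) (sym 1+m'≡m)) (f≡ x)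
    Tr≡0 : ∀ x → ⊤ → Tr x ≡ 0#
    Tr≡0 x _ with Tr-bit x
    ... | inj₁ Tr≡0 = Tr≡0
    ... | inj₂ Tr≡1 = ⊥-elim (∄Tr≡1 (Any.map (λ { refl → Tr≡1 }) (elems-complete x)))
    2^m≤ : 2 ℕ.^ m ≤ length (filter (λ _ → yes tt) elems)
    2^m≤ = ℕₚ.≤-reflexive (sym (trans (cong length (filter-all _ (All.universal _ elems))) card))
    2^[m-1]<2^m : 2 ℕ.^ m' < 2 ℕ.^ m
    2^[m-1]<2^m = subst (λ n → 2 ℕ.^ m' < 2 ℕ.^ n) 1+m'≡m (ℕₚ.^-monoʳ-< 2 (s≤s (s≤s z≤n)) (ℕₚ.n<1+n m'))

module CharacterSums {m : ℕ} (F : GF m) where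
  open GF F
  open GFOps F
  open FieldArithmetic F
  open PolynomialRoots F using (Tr-surjective)
  open ListFold _≟_ ℤₚ.+-0-isCommutativeMonoid public
  open import Data.Integer using (0ℤ; 1ℤ; -1ℤ)
  open ≡-Reasoning

  sumAll : (Carrier → ℤ) → ℤ
  sumAll f = fold elems f

  NonZero? : ∀ x → Dec (x ≢ 0#)
  NonZero? x = ¬? (x ≟ 0#)

  sumℤ≡fold : ∀ xs f → sumℤ xs f ≡ fold xs f
  sumℤ≡fold []       f = refl
  sumℤ≡fold (x ∷ xs) f = cong (λ s → f x ℤ.+ s) (sumℤ≡fold xs f)

  sumNZ≡sumAll : ∀ f → sumNZ f ≡ sumAll (λ x → f x when NonZero? x)
  sumNZ≡sumAll f = trans (sumℤ≡fold nonzero f) (fold-filter elems NonZero? f)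

  sumFiber≡sumAll : ∀ k q γ f → sumFiber k q γ f ≡ sumAll (λ s → f s when (RelTr k q s ≟ γ))
  sumFiber≡sumAll k q γ f = trans (sumℤ≡fold (filter (λ s → RelTr k q s ≟ γ) elems) f) (fold-filter elems (λ s → RelTr k q s ≟ γ) f)

  sumℤ-cong : ∀ xs {f g : Carrier → ℤ} → (∀ x → f x ≡ g x) → sumℤ xs f ≡ sumℤ xs g
  sumℤ-cong xs {f} {g} f≗g = trans (sumℤ≡fold xs f) (trans (fold-cong xs f≗g) (sym (sumℤ≡fold xs g)))

  sumAll-split0 : ∀ f → sumAll f ≡ f 0# ℤ.+ sumAll (λ x → f x when NonZero? x)
  sumAll-split0 f = trans (fold-remove f elems-unique (elems-complete 0#)) (cong (λ s → f 0# ℤ.+ s) (fold-filter elems NonZero? f))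

  sumAll-point : ∀ c (h : Carrier → ℤ) → sumAll (λ y → h y when (c ≟ y)) ≡ h c
  sumAll-point c = fold-point elems-unique (elems-complete c)

  sumAll-count : ∀ {P : Carrier → Set} (P? : ∀ x → Dec (P x)) → sumAll (λ x → 1ℤ when P? x) ≡ ℤ.+ length (filter P? elems)
  sumAll-count P? = trans (sym (fold-filter elems P? (λ _ → 1ℤ))) (count (filter P? elems))
    where
    count : ∀ xs → fold xs (λ _ → 1ℤ) ≡ ℤ.+ length xs
    count []       = refl
    count (x ∷ xs) = trans (cong (λ s → 1ℤ ℤ.+ s) (count xs)) (sym (ℤₚ.pos-+ 1 (length xs)))

  fold-*ˡ : ∀ xs c (f : Carrier → ℤ) → fold xs (λ x → c ℤ.* f x) ≡ c ℤ.* fold xs f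
  fold-*ˡ []       c f = sym (ℤₚ.*-zeroʳ c)
  fold-*ˡ (x ∷ xs) c f = trans (cong (λ s → c ℤ.* f x ℤ.+ s) (fold-*ˡ xs c f)) (sym (ℤₚ.*-distribˡ-+ c _ _))

  fold-neg : ∀ xs (f : Carrier → ℤ) → fold xs (λ x → ℤ.- f x) ≡ ℤ.- fold xs f
  fold-neg []       f = refl
  fold-neg (x ∷ xs) f = trans (cong (λ s → ℤ.- f x ℤ.+ s) (fold-neg xs f)) (sym (ℤₚ.neg-distrib-+ (f x) _))

  when-*ˡ : ∀ {P : Set} (d : Dec P) a b → (a ℤ.* b) when d ≡ a ℤ.* (b when d)
  when-*ˡ (yes _) a b = refl
  when-*ˡ (no _)  a b = sym (ℤₚ.*-zeroʳ a)

  when≡*1 : ∀ {P : Set} (d : Dec P) a → a when d ≡ a ℤ.* (1ℤ when d)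
  when≡*1 d a = trans (cong (_when d) (sym (ℤₚ.*-identityʳ a))) (when-*ˡ d a 1ℤ)

  *-when-swap : ∀ {P : Set} (d : Dec P) a b → a ℤ.* (b when d) ≡ b ℤ.* (a when d)
  *-when-swap (yes _) a b = ℤₚ.*-comm a b
  *-when-swap (no _)  a b = trans (ℤₚ.*-zeroʳ a) (sym (ℤₚ.*-zeroʳ b))

  when-neg : ∀ {P : Set} (d : Dec P) a → (ℤ.- a) when d ≡ ℤ.- (a when d)
  when-neg (yes _) a = refl
  when-neg (no _)  a = refl

  sumAll-when-*ˡ : ∀ {P : Carrier → Set} (P? : ∀ x → Dec (P x)) c (f : Carrier → ℤ)
                 → sumAll (λ x → (c ℤ.* f x) when P? x) ≡ c ℤ.* sumAll (λ x → f x when P? x)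
  sumAll-when-*ˡ P? c f = trans (fold-cong elems (λ x → when-*ˡ (P? x) c (f x))) (fold-*ˡ elems c _)

  sumAll-reindex : (σ τ : Carrier → Carrier) → (∀ x → σ (τ x) ≡ x) → (∀ x → τ (σ x) ≡ x)
                 → (f : Carrier → ℤ) → sumAll (f ∘ σ) ≡ sumAll f
  sumAll-reindex = fold-reindex elems-unique elems-complete

  sumAll-translate : ∀ c (f : Carrier → ℤ) → sumAll (λ x → f (x + c)) ≡ sumAll f
  sumAll-translate c = sumAll-reindex (_+ c) (_+ c) x+c+c≡x x+c+c≡x
    where
    x+c+c≡x : ∀ x → (x + c) + c ≡ x
    x+c+c≡x x = trans (+-assoc _ _ _) (trans (cong (x +_) (x+x≡0 c)) (+-identityʳ x))

  sumAll-dilate : ∀ {a} → a ≢ 0# → (f : Carrier → ℤ) → sumAll (λ x → f (x * a)) ≡ sumAll f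
  sumAll-dilate {a} a≢0 = sumAll-reindex (_* a) (_* inv a a≢0) (cancels (*-inverseʳ a a≢0)) (cancels (*-inverseˡ a a≢0))
    where
    cancels : ∀ {b c} → b * c ≡ 1# → ∀ x → (x * c) * b ≡ x
    cancels {b} {c} bc≡1 x = trans (*-assoc _ _ _) (trans (cong (x *_) (trans (*-comm c b) bc≡1)) (*-identityʳ x))

  sumAll-square : ∀ (f : Carrier → ℤ) → sumAll (λ x → f (x ²)) ≡ sumAll f
  sumAll-square = sumAll-reindex _² √ √-² ²-√

  S≡-S⇒S≡0 : ∀ {S} → S ≡ ℤ.- S → S ≡ 0ℤ
  S≡-S⇒S≡0 {S} S≡-S with ℤₚ.i*j≡0⇒i≡0∨j≡0 (ℤ.+ 2) {S} 2S≡0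
    where
    2S≡0 : ℤ.+ 2 ℤ.* S ≡ 0ℤ
    2S≡0 = begin
      ℤ.+ 2 ℤ.* S                  ≡⟨ ℤₚ.*-distribʳ-+ S 1ℤ 1ℤ ⟩
      1ℤ ℤ.* S ℤ.+ 1ℤ ℤ.* S    ≡⟨ cong₂ ℤ._+_ (ℤₚ.*-identityˡ S) (trans (ℤₚ.*-identityˡ S) S≡-S) ⟩
      S ℤ.+ ℤ.- S                ≡⟨ ℤₚ.+-inverseʳ S ⟩
      0ℤ                         ∎
  ... | inj₂ S≡0 = S≡0

  sgn-0 : sgn 0# ≡ 1ℤ
  sgn-0 with 0# ≟ 0#
  ... | yes _   = refl
  ... | no 0≢0 = ⊥-elim (0≢0 refl)

  sgn-1 : sgn 1# ≡ -1ℤ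
  sgn-1 with 1# ≟ 0#
  ... | yes 1≡0 = ⊥-elim (0≢1 (sym 1≡0))
  ... | no _    = refl

  sgn-+ : ∀ {a b} → Bit a → Bit b → sgn (a + b) ≡ sgn a ℤ.* sgn b
  sgn-+ (inj₁ refl) (inj₁ refl) = trans (cong sgn (+-identityˡ 0#)) (trans sgn-0 (cong₂ ℤ._*_ (sym sgn-0) (sym sgn-0)))
  sgn-+ (inj₁ refl) (inj₂ refl) = trans (cong sgn (+-identityˡ 1#)) (trans sgn-1 (cong₂ ℤ._*_ (sym sgn-0) (sym sgn-1)))
  sgn-+ (inj₂ refl) (inj₁ refl) = trans (cong sgn (+-identityʳ 1#)) (trans sgn-1 (cong₂ ℤ._*_ (sym sgn-1) (sym sgn-0)))
  sgn-+ (inj₂ refl) (inj₂ refl) = trans (cong sgn (x+x≡0 1#)) (trans sgn-0 (cong₂ ℤ._*_ (sym sgn-1) (sym sgn-1)))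

  sgn-Tr-+ : ∀ x y → sgn (Tr (x + y)) ≡ sgn (Tr x) ℤ.* sgn (Tr y)
  sgn-Tr-+ x y = trans (cong sgn (Tr-+ x y)) (sgn-+ (Tr-bit x) (Tr-bit y))

  sgn-Tr-*-combine : ∀ a i b → sgn (Tr a) ℤ.* (i ℤ.* sgn (Tr b)) ≡ i ℤ.* sgn (Tr (a + b))
  sgn-Tr-*-combine a i b = begin
    sgn (Tr a) ℤ.* (i ℤ.* sgn (Tr b))    ≡⟨ sym (ℤₚ.*-assoc (sgn (Tr a)) i (sgn (Tr b))) ⟩
    sgn (Tr a) ℤ.* i ℤ.* sgn (Tr b)      ≡⟨ cong (ℤ._* sgn (Tr b)) (ℤₚ.*-comm (sgn (Tr a)) i) ⟩
    i ℤ.* sgn (Tr a) ℤ.* sgn (Tr b)      ≡⟨ ℤₚ.*-assoc i (sgn (Tr a)) (sgn (Tr b)) ⟩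
    i ℤ.* (sgn (Tr a) ℤ.* sgn (Tr b))    ≡⟨ cong (i ℤ.*_) (sym (sgn-Tr-+ a b)) ⟩
    i ℤ.* sgn (Tr (a + b))               ∎

  sgn-Tr-0 : sgn (Tr 0#) ≡ 1ℤ
  sgn-Tr-0 = trans (cong sgn Tr-0) sgn-0

  sgn-Tr-flip : ∀ {x t} → Tr t ≡ 1# → sgn (Tr (x + t)) ≡ ℤ.- sgn (Tr x)
  sgn-Tr-flip {x} {t} Tr-t≡1 = begin
    sgn (Tr (x + t))              ≡⟨ sgn-Tr-+ x t ⟩
    sgn (Tr x) ℤ.* sgn (Tr t)     ≡⟨ cong (λ b → sgn (Tr x) ℤ.* sgn b) Tr-t≡1 ⟩
    sgn (Tr x) ℤ.* sgn 1#         ≡⟨ cong (sgn (Tr x) ℤ.*_) sgn-1 ⟩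
    sgn (Tr x) ℤ.* -1ℤ        ≡⟨ ℤₚ.*-comm (sgn (Tr x)) (-1ℤ) ⟩
    -1ℤ ℤ.* sgn (Tr x)        ≡⟨ ℤₚ.-1*i≡-i (sgn (Tr x)) ⟩
    ℤ.- sgn (Tr x)                ∎

  -- Translating x by a⁻¹t, where Tr t = 1, negates every term, so the sum is its own negative.
  orthogonality : ∀ {a} → a ≢ 0# → sumAll (λ x → sgn (Tr (a * x))) ≡ 0ℤ
  orthogonality {a} a≢0 = S≡-S⇒S≡0 (begin
    sumAll (λ x → sgn (Tr (a * x)))          ≡⟨ sym (sumAll-translate c _) ⟩
    sumAll (λ x → sgn (Tr (a * (x + c))))    ≡⟨ fold-cong elems (λ x → trans (cong (λ y → sgn (Tr y)) (a[x+c]≡ax+t x)) (sgn-Tr-flip Tr-t≡1)) ⟩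
    sumAll (λ x → ℤ.- sgn (Tr (a * x)))      ≡⟨ fold-neg elems _ ⟩
    ℤ.- sumAll (λ x → sgn (Tr (a * x)))      ∎)
    where
    t = proj₁ Tr-surjective
    Tr-t≡1 = proj₂ Tr-surjective
    c = inv a a≢0 * t
    a[x+c]≡ax+t : ∀ x → a * (x + c) ≡ a * x + t
    a[x+c]≡ax+t x = trans (distribˡ a x c)
      (cong (a * x +_) (trans (sym (*-assoc _ _ _)) (trans (cong (_* t) (*-inverseʳ a a≢0)) (*-identityˡ t))))

module RelativeTrace {m : ℕ} (F : GF m) {k q r : ℕ} (q≡1+2r : q ≡ suc (2 ℕ.* r)) (k*q≡m : k ℕ.* q ≡ m) where
  open GF F
  open GFOps F
  open FieldArithmetic F
  open PolynomialRoots F using (roots-≤; RelTr-isMonic; x^2^k+x-isMonic; Tr-surjective)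
  open CharacterSums F
  open import Data.Integer using (0ℤ; 1ℤ)
  open ≡-Reasoning

  T : Carrier → Carrier
  T = RelTr k q

  Sub : Carrier → Set
  Sub = InSubfield k

  Sub? : ∀ y → Dec (Sub y)
  Sub? y = (y ^ⁿ (2 ℕ.^ k)) ≟ y

  1≤k : 1 ≤ k
  1≤k = ℕₚ.n≢0⇒n>0 (λ k≡0 → ℕₚ.<⇒≢ 1≤m (sym (trans (sym k*q≡m) (cong (ℕ._* q) k≡0))))

  k≤m : k ≤ m
  k≤m = subst (k ≤_) k*q≡m (ℕₚ.m≤m*n k q)
    where instance _ = subst ℕ.NonZero (sym q≡1+2r) _

  2^k[1+i]≡2^k*2^ki : ∀ i → 2 ℕ.^ (k ℕ.* suc i) ≡ 2 ℕ.^ k ℕ.* 2 ℕ.^ (k ℕ.* i)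
  2^k[1+i]≡2^k*2^ki i = trans (cong (2 ℕ.^_) (ℕₚ.*-suc k i)) (ℕₚ.^-distribˡ-+-* 2 k (k ℕ.* i))

  x^2^k0≡x : ∀ x → x ^ⁿ (2 ℕ.^ (k ℕ.* 0)) ≡ x
  x^2^k0≡x x = trans (cong (λ n → x ^ⁿ (2 ℕ.^ n)) (ℕₚ.*-zeroʳ k)) (*-identityʳ x)

  Sub-^2^ki : ∀ {c} → Sub c → ∀ i → c ^ⁿ (2 ℕ.^ (k ℕ.* i)) ≡ c
  Sub-^2^ki {c} c∈ zero    = x^2^k0≡x c
  Sub-^2^ki {c} c∈ (suc i) = begin
    c ^ⁿ (2 ℕ.^ (k ℕ.* suc i))                  ≡⟨ cong (c ^ⁿ_) (2^k[1+i]≡2^k*2^ki i) ⟩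
    c ^ⁿ (2 ℕ.^ k ℕ.* 2 ℕ.^ (k ℕ.* i))          ≡⟨ sym (^-*-assoc c (2 ℕ.^ k) (2 ℕ.^ (k ℕ.* i))) ⟩
    (c ^ⁿ (2 ℕ.^ k)) ^ⁿ (2 ℕ.^ (k ℕ.* i))       ≡⟨ cong (_^ⁿ (2 ℕ.^ (k ℕ.* i))) c∈ ⟩
    c ^ⁿ (2 ℕ.^ (k ℕ.* i))                      ≡⟨ Sub-^2^ki c∈ i ⟩
    c                                           ∎

  Sub-0 : Sub 0#
  Sub-0 = 0^2^j≡0 k

  Sub-^ : ∀ {a} → Sub a → ∀ n → Sub (a ^ⁿ n)
  Sub-^ {a} a∈ n = trans (^-comm a n (2 ℕ.^ k)) (cong (_^ⁿ n) a∈)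

  Sub-² : ∀ {a} → Sub a → Sub (a ²)
  Sub-² {a} a∈ = subst Sub (x^2≡x² a) (Sub-^ a∈ 2)

  Sub-√ : ∀ {a} → Sub (a ²) → Sub a
  Sub-√ {a} a²∈ = subst Sub (²-√ a) (Sub-^ a²∈ (2 ℕ.^ (m ℕ.∸ 1)))

  -- Each of the q terms is c, and q is odd.
  T-Sub : ∀ {c} → Sub c → T c ≡ c
  T-Sub {c} c∈ = trans (Σ<-cong q (Sub-^2^ki c∈)) (trans (cong (λ n → Σ< n (λ _ → c)) q≡1+2r) (Σ<-odd-const r c))

  T-+ : ∀ x y → T (x + y) ≡ T x + T y
  T-+ x y = trans (Σ<-cong q (λ i → frobenius-+ x y (k ℕ.* i))) (Σ<-+ q _ _)

  T-² : ∀ s → T (s ²) ≡ (T s) ²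
  T-² s = trans (Σ<-cong q (λ i → ^-distribʳ-* s s (2 ℕ.^ (k ℕ.* i)))) (sym (Σ<-hom q _ _² (zeroˡ 0#) ²-+))

  T-*ˡ : ∀ {c} → Sub c → ∀ s → T (c * s) ≡ c * T s
  T-*ˡ {c} c∈ s = trans (Σ<-cong q (λ i → trans (^-distribʳ-* c s (2 ℕ.^ (k ℕ.* i))) (cong (_* s ^ⁿ (2 ℕ.^ (k ℕ.* i))) (Sub-^2^ki c∈ i))))
                        (sym (Σ<-*ˡ q c _))

  T∈Sub : ∀ s → Sub (T s)
  T∈Sub s = begin
    (T s) ^ⁿ (2 ℕ.^ k)                                  ≡⟨ frobenius-Σ< q _ k ⟩
    Σ< q (λ i → (s ^ⁿ (2 ℕ.^ (k ℕ.* i))) ^ⁿ (2 ℕ.^ k))  ≡⟨ Σ<-cong q shift ⟩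
    Σ< q (λ i → s ^ⁿ (2 ℕ.^ (k ℕ.* suc i)))             ≡⟨ Σ<-rotate q (λ i → s ^ⁿ (2 ℕ.^ (k ℕ.* i))) wrap ⟩
    T s                                                 ∎
    where
    shift : ∀ i → (s ^ⁿ (2 ℕ.^ (k ℕ.* i))) ^ⁿ (2 ℕ.^ k) ≡ s ^ⁿ (2 ℕ.^ (k ℕ.* suc i))
    shift i = trans (^-*-assoc s (2 ℕ.^ (k ℕ.* i)) (2 ℕ.^ k))
                    (cong (s ^ⁿ_) (trans (ℕₚ.*-comm (2 ℕ.^ (k ℕ.* i)) (2 ℕ.^ k)) (sym (2^k[1+i]≡2^k*2^ki i))))
    wrap : s ^ⁿ (2 ℕ.^ (k ℕ.* q)) ≡ s ^ⁿ (2 ℕ.^ (k ℕ.* 0))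
    wrap = trans (cong (λ n → s ^ⁿ (2 ℕ.^ n)) k*q≡m) (trans (x^2^m≡x s) (sym (x^2^k0≡x s)))

  Tr-T : ∀ s → Tr (T s) ≡ Tr s
  Tr-T s = begin
    Tr (T s)                                  ≡⟨ Σ<-hom q _ Tr Tr-0 Tr-+ ⟩
    Σ< q (λ i → Tr (s ^ⁿ (2 ℕ.^ (k ℕ.* i))))  ≡⟨ Σ<-cong q (λ i → Tr-frobenius s (k ℕ.* i)) ⟩
    Σ< q (λ _ → Tr s)                         ≡⟨ cong (λ n → Σ< n (λ _ → Tr s)) q≡1+2r ⟩
    Σ< (suc (2 ℕ.* r)) (λ _ → Tr s)           ≡⟨ Σ<-odd-const r (Tr s) ⟩
    Tr s                                      ∎

  Tr-*Sub : ∀ {c} → Sub c → ∀ y → Tr (c * y) ≡ Tr (c * T y)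
  Tr-*Sub c∈ y = trans (sym (Tr-T _)) (cong Tr (T-*ˡ c∈ y))

  Tr-T-adjoint : ∀ w s → Tr (w * T s) ≡ Tr (T w * s)
  Tr-T-adjoint w s = begin
    Tr (w * T s)      ≡⟨ cong Tr (*-comm _ _) ⟩
    Tr (T s * w)      ≡⟨ Tr-*Sub (T∈Sub s) w ⟩
    Tr (T s * T w)    ≡⟨ cong Tr (*-comm _ _) ⟩
    Tr (T w * T s)    ≡⟨ sym (Tr-*Sub (T∈Sub w) s) ⟩
    Tr (T w * s)      ∎

  |kerT| : ℕ
  |kerT| = length (filter (λ s → T s ≟ 0#) elems)

  |Sub| : ℕ
  |Sub| = length (filter Sub? elems)

  fiber-size : ∀ y → sumAll (λ s → 1ℤ when (T s ≟ y)) ≡ ℤ.+ |kerT| when Sub? y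
  fiber-size y with Sub? y
  ... | yes y∈ = begin
    sumAll (λ s → 1ℤ when (T s ≟ y))        ≡⟨ sym (sumAll-translate y _) ⟩
    sumAll (λ s → 1ℤ when (T (s + y) ≟ y))  ≡⟨ fold-cong elems (λ s → when-iff (T (s + y) ≟ y) (T s ≟ 0#) 1ℤ (T[s+y]≡y⇒Ts≡0 s) (Ts≡0⇒T[s+y]≡y s)) ⟩
    sumAll (λ s → 1ℤ when (T s ≟ 0#))       ≡⟨ sumAll-count (λ s → T s ≟ 0#) ⟩
    ℤ.+ |kerT|                              ∎
    where
    T[s+y]≡Ts+y : ∀ s → T (s + y) ≡ T s + y
    T[s+y]≡Ts+y s = trans (T-+ s y) (cong (T s +_) (T-Sub y∈))
    T[s+y]≡y⇒Ts≡0 : ∀ s → T (s + y) ≡ y → T s ≡ 0#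
    T[s+y]≡y⇒Ts≡0 s T[s+y]≡y = +-cancelˡ _ _ _ (trans (+-comm y (T s)) (trans (sym (T[s+y]≡Ts+y s)) (trans T[s+y]≡y (sym (+-identityʳ y)))))
    Ts≡0⇒T[s+y]≡y : ∀ s → T s ≡ 0# → T (s + y) ≡ y
    Ts≡0⇒T[s+y]≡y s Ts≡0 = trans (T[s+y]≡Ts+y s) (trans (cong (_+ y) Ts≡0) (+-identityˡ y))
  ... | no y∉ = trans (fold-cong elems (λ s → when-no (T s ≟ y) 1ℤ (λ Ts≡y → y∉ (subst Sub Ts≡y (T∈Sub s))))) (fold-ε elems)

  -- T is |kerT|-to-one onto the subfield.
  sumAll-∘T : ∀ (g : Carrier → ℤ) → sumAll (g ∘ T) ≡ ℤ.+ |kerT| ℤ.* sumAll (λ y → g y when Sub? y)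
  sumAll-∘T g = begin
    sumAll (λ s → g (T s))                                      ≡⟨ fold-cong elems (λ s → sym (sumAll-point (T s) g)) ⟩
    sumAll (λ s → sumAll (λ y → g y when (T s ≟ y)))            ≡⟨ fold-swap elems elems _ ⟩
    sumAll (λ y → sumAll (λ s → g y when (T s ≟ y)))            ≡⟨ fold-cong elems (λ y → trans (fold-cong elems (λ s → when≡*1 (T s ≟ y) (g y))) (fold-*ˡ elems (g y) _)) ⟩
    sumAll (λ y → g y ℤ.* sumAll (λ s → 1ℤ when (T s ≟ y)))     ≡⟨ fold-cong elems (λ y → cong (g y ℤ.*_) (fiber-size y)) ⟩
    sumAll (λ y → g y ℤ.* (ℤ.+ |kerT| when Sub? y))             ≡⟨ fold-cong elems (λ y → *-when-swap (Sub? y) (g y) (ℤ.+ |kerT|)) ⟩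
    sumAll (λ y → ℤ.+ |kerT| ℤ.* (g y when Sub? y))             ≡⟨ fold-*ˡ elems (ℤ.+ |kerT|) (λ y → g y when Sub? y) ⟩
    ℤ.+ |kerT| ℤ.* sumAll (λ y → g y when Sub? y)               ∎

  |kerT|*|Sub|≡2^m : |kerT| ℕ.* |Sub| ≡ 2 ℕ.^ m
  |kerT|*|Sub|≡2^m = ℤₚ.+-injective (begin
    ℤ.+ (|kerT| ℕ.* |Sub|)                       ≡⟨ ℤₚ.pos-* |kerT| |Sub| ⟩
    ℤ.+ |kerT| ℤ.* ℤ.+ |Sub|                     ≡⟨ cong (ℤ.+ |kerT| ℤ.*_) (sym (sumAll-count Sub?)) ⟩
    ℤ.+ |kerT| ℤ.* sumAll (λ y → 1ℤ when Sub? y) ≡⟨ sym (sumAll-∘T (λ _ → 1ℤ)) ⟩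
    sumAll (λ _ → 1ℤ)                            ≡⟨ trans (fold-cong elems (λ x → sym (when-yes (yes tt) 1ℤ tt))) (sumAll-count (λ _ → yes tt)) ⟩
    ℤ.+ length (filter (λ _ → yes tt) elems)     ≡⟨ cong (λ xs → ℤ.+ length xs) (filter-all _ (All.universal _ elems)) ⟩
    ℤ.+ length elems                             ≡⟨ cong ℤ.+_ card ⟩
    ℤ.+ (2 ℕ.^ m)                                ∎)

  -- Both counts are bounded by the degrees of monic polynomials they are roots of, and the bounds multiply to 2^m.
  |kerT|≡2^[m-k] : |kerT| ≡ 2 ℕ.^ (m ℕ.∸ k)
  |kerT|≡2^[m-k] = *-tightˡ |kerT|≤ |Sub|≤ (trans |kerT|*|Sub|≡2^m 2^m≡) (ℕₚ.m^n>0 2 k)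
    where
    m≡k+k*2r : m ≡ k ℕ.+ k ℕ.* (2 ℕ.* r)
    m≡k+k*2r = trans (sym k*q≡m) (trans (cong (k ℕ.*_) q≡1+2r) (ℕₚ.*-suc k (2 ℕ.* r)))
    m-k≡k*2r : m ℕ.∸ k ≡ k ℕ.* (2 ℕ.* r)
    m-k≡k*2r = trans (cong (ℕ._∸ k) m≡k+k*2r) (ℕₚ.m+n∸m≡n k _)
    |kerT|≤ : |kerT| ≤ 2 ℕ.^ (m ℕ.∸ k)
    |kerT|≤ = subst (λ n → |kerT| ≤ 2 ℕ.^ n) (sym m-k≡k*2r)
      (roots-≤ (RelTr-isMonic 1≤k (2 ℕ.* r)) (λ s → T s ≟ 0#) (λ s Ts≡0 → trans (cong (λ n → RelTr k n s) (sym q≡1+2r)) Ts≡0))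
    |Sub|≤ : |Sub| ≤ 2 ℕ.^ k
    |Sub|≤ = roots-≤ (x^2^k+x-isMonic 1≤k) Sub? (λ y y∈ → trans (cong (_+ y) y∈) (x+x≡0 y))
    2^m≡ : 2 ℕ.^ m ≡ 2 ℕ.^ (m ℕ.∸ k) ℕ.* 2 ℕ.^ k
    2^m≡ = trans (cong (2 ℕ.^_) (sym (ℕₚ.m∸n+n≡m k≤m))) (ℕₚ.^-distribˡ-+-* 2 (m ℕ.∸ k) k)

  fiberCharSum : Carrier → Carrier → ℤ
  fiberCharSum w γ = sumAll (λ s → sgn (Tr (w * s)) when (T s ≟ γ))

  fiberCharSum-Sub : ∀ {w γ} → Sub w → Sub γ → fiberCharSum w γ ≡ ℤ.+ |kerT| ℤ.* sgn (Tr (w * γ))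
  fiberCharSum-Sub {w} {γ} w∈ γ∈ = begin
    fiberCharSum w γ                                 ≡⟨ fold-cong elems (λ s → when-cong (T s ≟ γ) (Tr-constant s)) ⟩
    sumAll (λ s → ε when (T s ≟ γ))                  ≡⟨ fold-cong elems (λ s → when≡*1 (T s ≟ γ) ε) ⟩
    sumAll (λ s → ε ℤ.* (1ℤ when (T s ≟ γ)))         ≡⟨ fold-*ˡ elems ε (λ s → 1ℤ when (T s ≟ γ)) ⟩
    ε ℤ.* sumAll (λ s → 1ℤ when (T s ≟ γ))           ≡⟨ cong (ε ℤ.*_) (trans (fiber-size γ) (when-yes (Sub? γ) (ℤ.+ |kerT|) γ∈)) ⟩
    ε ℤ.* ℤ.+ |kerT|                                 ≡⟨ ℤₚ.*-comm ε (ℤ.+ |kerT|) ⟩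
    ℤ.+ |kerT| ℤ.* ε                                 ∎
    where
    ε = sgn (Tr (w * γ))
    Tr-constant : ∀ s → T s ≡ γ → sgn (Tr (w * s)) ≡ ε
    Tr-constant s Ts≡γ = cong sgn (trans (Tr-*Sub w∈ s) (cong (λ y → Tr (w * y)) Ts≡γ))

  -- If Tr(w t) = 0 on all of ker T then Tr((w + T w) s) = Tr(w (s + T s)) = 0 for every s, so w = T w;
  -- hence some t ∈ ker T has Tr(w t) = 1, and translating by t negates the sum.
  fiberCharSum-∉Sub : ∀ {w} γ → ¬ Sub w → fiberCharSum w γ ≡ 0ℤ
  fiberCharSum-∉Sub {w} γ w∉ with any? (λ t → T t ≟ 0# ×-dec Tr (w * t) ≟ 1#) elems
  ... | yes ∃t = S≡-S⇒S≡0 (begin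
    fiberCharSum w γ                                              ≡⟨ sym (sumAll-translate t _) ⟩
    sumAll (λ s → sgn (Tr (w * (s + t))) when (T (s + t) ≟ γ))    ≡⟨ fold-cong elems negated ⟩
    sumAll (λ s → ℤ.- (sgn (Tr (w * s)) when (T s ≟ γ)))          ≡⟨ fold-neg elems _ ⟩
    ℤ.- fiberCharSum w γ                                          ∎)
    where
    t = proj₁ (satisfied ∃t)
    Tt≡0 = proj₁ (proj₂ (satisfied ∃t))
    Tr-wt≡1 = proj₂ (proj₂ (satisfied ∃t))
    T[s+t]≡Ts : ∀ s → T (s + t) ≡ T s
    T[s+t]≡Ts s = trans (T-+ s t) (trans (cong (T s +_) Tt≡0) (+-identityʳ _))
    negated : ∀ s → sgn (Tr (w * (s + t))) when (T (s + t) ≟ γ) ≡ ℤ.- (sgn (Tr (w * s)) when (T s ≟ γ))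
    negated s = begin
      sgn (Tr (w * (s + t))) when (T (s + t) ≟ γ)  ≡⟨ when-iff (T (s + t) ≟ γ) (T s ≟ γ) _ (trans (sym (T[s+t]≡Ts s))) (trans (T[s+t]≡Ts s)) ⟩
      sgn (Tr (w * (s + t))) when (T s ≟ γ)        ≡⟨ cong (_when (T s ≟ γ)) (trans (cong (λ y → sgn (Tr y)) (distribˡ w s t)) (sgn-Tr-flip Tr-wt≡1)) ⟩
      ℤ.- sgn (Tr (w * s)) when (T s ≟ γ)          ≡⟨ when-neg (T s ≟ γ) _ ⟩
      ℤ.- (sgn (Tr (w * s)) when (T s ≟ γ))        ∎
  ... | no ∄t = ⊥-elim (w∉ (subst Sub (sym w≡Tw) (T∈Sub w)))
    where
    Tr-w-ker≡0 : ∀ t → T t ≡ 0# → Tr (w * t) ≡ 0#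
    Tr-w-ker≡0 t Tt≡0 with Tr-bit (w * t)
    ... | inj₁ Tr≡0 = Tr≡0
    ... | inj₂ Tr≡1 = ⊥-elim (∄t (Any.map (λ { refl → Tt≡0 , Tr≡1 }) (elems-complete t)))
    c = w + T w
    Tr-c*≡0 : ∀ s → Tr (c * s) ≡ 0#
    Tr-c*≡0 s = begin
      Tr ((w + T w) * s)             ≡⟨ cong Tr (distribʳ s w (T w)) ⟩
      Tr (w * s + T w * s)           ≡⟨ Tr-+ _ _ ⟩
      Tr (w * s) + Tr (T w * s)      ≡⟨ cong (Tr (w * s) +_) (sym (Tr-T-adjoint w s)) ⟩
      Tr (w * s) + Tr (w * T s)      ≡⟨ sym (Tr-+ _ _) ⟩
      Tr (w * s + w * T s)           ≡⟨ cong Tr (sym (distribˡ w s (T s))) ⟩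
      Tr (w * (s + T s))             ≡⟨ Tr-w-ker≡0 _ (trans (T-+ s (T s)) (trans (cong (T s +_) (T-Sub (T∈Sub s))) (x+x≡0 _))) ⟩
      0#                             ∎
    c≡0 : c ≡ 0#
    c≡0 with c ≟ 0#
    ... | yes c≡0 = c≡0
    ... | no  c≢0 = ⊥-elim (0≢1 (trans (sym (Tr-c*≡0 (inv c c≢0 * t₁))) (trans (cong Tr c[c⁻¹t₁]≡t₁) Tr-t₁≡1)))
      where
      t₁ = proj₁ Tr-surjective
      Tr-t₁≡1 = proj₂ Tr-surjective
      c[c⁻¹t₁]≡t₁ : c * (inv c c≢0 * t₁) ≡ t₁
      c[c⁻¹t₁]≡t₁ = trans (sym (*-assoc _ _ _)) (trans (cong (_* t₁) (*-inverseʳ c c≢0)) (*-identityˡ t₁))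
    w≡Tw : w ≡ T w
    w≡Tw = x+y≡0⇒x≡y c≡0

  fiberCharSum≡ : ∀ w {γ} → Sub γ → fiberCharSum w γ ≡ (ℤ.+ |kerT| ℤ.* sgn (Tr (w * γ))) when Sub? w
  fiberCharSum≡ w γ∈ with Sub? w
  ... | yes w∈ = fiberCharSum-Sub w∈ γ∈
  ... | no  w∉ = fiberCharSum-∉Sub _ w∉

  subfieldCharSum : Carrier → ℤ
  subfieldCharSum b = sumAll (λ y → sgn (Tr (y * b)) when Sub? y)

  subfieldCharSum-0 : subfieldCharSum 0# ≡ ℤ.+ |Sub|
  subfieldCharSum-0 = trans (fold-cong elems (λ y → cong (_when Sub? y) (trans (cong (λ x → sgn (Tr x)) (zeroʳ y)) sgn-Tr-0)))
                            (sumAll-count Sub?)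

  subfieldCharSum-≢0 : ∀ {b} → Sub b → b ≢ 0# → subfieldCharSum b ≡ 0ℤ
  subfieldCharSum-≢0 {b} b∈ b≢0 with ℤₚ.i*j≡0⇒i≡0∨j≡0 (ℤ.+ |kerT|) |kerT|*S≡0
    where
    Tr[Ts*b]≡Tr[b*s] : ∀ s → Tr (T s * b) ≡ Tr (b * s)
    Tr[Ts*b]≡Tr[b*s] s = trans (cong Tr (*-comm _ _)) (trans (Tr-T-adjoint b s) (cong (λ c → Tr (c * s)) (T-Sub b∈)))
    |kerT|*S≡0 : ℤ.+ |kerT| ℤ.* subfieldCharSum b ≡ 0ℤ
    |kerT|*S≡0 = begin
      ℤ.+ |kerT| ℤ.* subfieldCharSum b    ≡⟨ sym (sumAll-∘T (λ y → sgn (Tr (y * b)))) ⟩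
      sumAll (λ s → sgn (Tr (T s * b)))   ≡⟨ fold-cong elems (λ s → cong sgn (Tr[Ts*b]≡Tr[b*s] s)) ⟩
      sumAll (λ s → sgn (Tr (b * s)))     ≡⟨ orthogonality b≢0 ⟩
      0ℤ                                  ∎
  ... | inj₁ |kerT|≡0 = ⊥-elim (ℕₚ.<⇒≢ (subst (0 <_) (sym |kerT|≡2^[m-k]) (ℕₚ.m^n>0 2 (m ℕ.∸ k))) (sym (ℤₚ.+-injective |kerT|≡0)))
  ... | inj₂ S≡0      = S≡0

  sumFiber-swap : ∀ γ (f : Carrier → ℤ) (W : Carrier → Carrier)
                → sumFiber k q γ (λ s → sumNZ (λ x → f x ℤ.* sgn (Tr (W x * s))))
                  ≡ sumAll (λ x → (f x ℤ.* fiberCharSum (W x) γ) when NonZero? x)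
  sumFiber-swap γ f W = begin
    sumFiber k q γ (λ s → sumNZ (λ x → χ x s))
      ≡⟨ sumFiber≡sumAll k q γ _ ⟩
    sumAll (λ s → sumNZ (λ x → χ x s) when (T s ≟ γ))
      ≡⟨ fold-cong elems (λ s → trans (cong (_when (T s ≟ γ)) (sumNZ≡sumAll _)) (fold-when elems (T s ≟ γ) _)) ⟩
    sumAll (λ s → sumAll (λ x → (χ x s when NonZero? x) when (T s ≟ γ)))
      ≡⟨ fold-swap elems elems _ ⟩
    sumAll (λ x → sumAll (λ s → (χ x s when NonZero? x) when (T s ≟ γ)))
      ≡⟨ fold-cong elems inner ⟩
    sumAll (λ x → (f x ℤ.* fiberCharSum (W x) γ) when NonZero? x) ∎
    where
    χ : Carrier → Carrier → ℤ
    χ x s = f x ℤ.* sgn (Tr (W x * s))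
    inner : ∀ x → sumAll (λ s → (χ x s when NonZero? x) when (T s ≟ γ)) ≡ (f x ℤ.* fiberCharSum (W x) γ) when NonZero? x
    inner x = begin
      sumAll (λ s → (χ x s when NonZero? x) when (T s ≟ γ))
        ≡⟨ fold-cong elems (λ s → trans (when-comm (T s ≟ γ) (NonZero? x) _) (cong (_when NonZero? x) (when-*ˡ (T s ≟ γ) (f x) _))) ⟩
      sumAll (λ s → (f x ℤ.* (sgn (Tr (W x * s)) when (T s ≟ γ))) when NonZero? x)
        ≡⟨ sym (fold-when elems (NonZero? x) _) ⟩
      sumAll (λ s → f x ℤ.* (sgn (Tr (W x * s)) when (T s ≟ γ))) when NonZero? x
        ≡⟨ cong (_when NonZero? x) (fold-*ˡ elems (f x) _) ⟩
      (f x ℤ.* fiberCharSum (W x) γ) when NonZero? x ∎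

  fiberSummand : (Carrier → ℤ) → (Carrier → Carrier) → Carrier → Carrier → ℤ
  fiberSummand f W γ x = (f x ℤ.* ((ℤ.+ |kerT| ℤ.* sgn (Tr (W x * γ))) when Sub? (W x))) when NonZero? x

  sumFiber≡sumAll-fiberSummand : ∀ {γ} → Sub γ → ∀ f W
    → sumFiber k q γ (λ s → sumNZ (λ x → f x ℤ.* sgn (Tr (W x * s)))) ≡ sumAll (fiberSummand f W γ)
  sumFiber≡sumAll-fiberSummand γ∈ f W = trans (sumFiber-swap _ f W)
    (fold-cong elems (λ x → cong (λ A → (f x ℤ.* A) when NonZero? x) (fiberCharSum≡ (W x) γ∈)))

  subfieldSummand : Carrier → Carrier → ℤ
  subfieldSummand z y = ((ℤ.+ |kerT| ℤ.* sgn (Tr (y * z))) when Sub? y) when NonZero? y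

  subfieldSum : Carrier → ℤ
  subfieldSum z = sumAll (subfieldSummand z)

  subfieldSum≡ : ∀ z → subfieldSum z ≡ ℤ.+ |kerT| ℤ.* subfieldCharSum (T z) ℤ.- ℤ.+ |kerT|
  subfieldSum≡ z = begin
    subfieldSum z                              ≡⟨ shift (g 0#) (subfieldSum z) ⟩
    (g 0# ℤ.+ subfieldSum z) ℤ.- g 0#          ≡⟨ cong₂ ℤ._-_ (sym (sumAll-split0 g)) g0≡ ⟩
    sumAll g ℤ.- ℤ.+ |kerT|                    ≡⟨ cong (ℤ._- ℤ.+ |kerT|) (trans (fold-cong elems g≡) (sumAll-when-*ˡ Sub? (ℤ.+ |kerT|) _)) ⟩
    ℤ.+ |kerT| ℤ.* subfieldCharSum (T z) ℤ.- ℤ.+ |kerT| ∎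
    where
    g : Carrier → ℤ
    g y = (ℤ.+ |kerT| ℤ.* sgn (Tr (y * z))) when Sub? y
    g0≡ : g 0# ≡ ℤ.+ |kerT|
    g0≡ = trans (when-yes (Sub? 0#) _ Sub-0)
                (trans (cong (λ x → ℤ.+ |kerT| ℤ.* sgn (Tr x)) (zeroˡ z)) (trans (cong (ℤ.+ |kerT| ℤ.*_) sgn-Tr-0) (ℤₚ.*-identityʳ _)))
    g≡ : ∀ y → g y ≡ (ℤ.+ |kerT| ℤ.* sgn (Tr (y * T z))) when Sub? y
    g≡ y = when-cong (Sub? y) (λ y∈ → cong (λ x → ℤ.+ |kerT| ℤ.* sgn x) (Tr-*Sub y∈ z))
    shift : ∀ a R → R ≡ (a ℤ.+ R) ℤ.- a
    shift = solve-∀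

  subfieldSum-ker : ∀ {z} → T z ≡ 0# → subfieldSum z ≡ bigVal m k
  subfieldSum-ker {z} Tz≡0 = begin
    subfieldSum z                                           ≡⟨ subfieldSum≡ z ⟩
    ℤ.+ |kerT| ℤ.* subfieldCharSum (T z) ℤ.- ℤ.+ |kerT|     ≡⟨ cong (λ S → ℤ.+ |kerT| ℤ.* S ℤ.- ℤ.+ |kerT|) (trans (cong subfieldCharSum Tz≡0) subfieldCharSum-0) ⟩
    ℤ.+ |kerT| ℤ.* ℤ.+ |Sub| ℤ.- ℤ.+ |kerT|
      ≡⟨ cong₂ ℤ._-_ (trans (sym (ℤₚ.pos-* |kerT| |Sub|)) (cong ℤ.+_ |kerT|*|Sub|≡2^m)) (cong ℤ.+_ |kerT|≡2^[m-k]) ⟩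
    bigVal m k                                              ∎

  subfieldSum-∉ker : ∀ {z} → T z ≢ 0# → subfieldSum z ≡ smallVal m k
  subfieldSum-∉ker {z} Tz≢0 = begin
    subfieldSum z                                           ≡⟨ subfieldSum≡ z ⟩
    ℤ.+ |kerT| ℤ.* subfieldCharSum (T z) ℤ.- ℤ.+ |kerT|     ≡⟨ cong (λ S → ℤ.+ |kerT| ℤ.* S ℤ.- ℤ.+ |kerT|) (subfieldCharSum-≢0 (T∈Sub z) Tz≢0) ⟩
    ℤ.+ |kerT| ℤ.* 0ℤ ℤ.- ℤ.+ |kerT|                        ≡⟨ cong (ℤ._- ℤ.+ |kerT|) (ℤₚ.*-zeroʳ (ℤ.+ |kerT|)) ⟩
    0ℤ ℤ.- ℤ.+ |kerT|                                       ≡⟨ ℤₚ.+-identityˡ _ ⟩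
    ℤ.- ℤ.+ |kerT|                                          ≡⟨ cong (λ n → ℤ.- ℤ.+ n) |kerT|≡2^[m-k] ⟩
    smallVal m k                                            ∎


module ExponentArithmetic {m : ℕ} (F : GF m) where
  open GF F
  open GFOps F
  open FieldArithmetic F
  open Congruences
  open ≡-Reasoning

  x^[b+nM]≡x^b : ∀ {x} → x ≢ 0# → ∀ b n → x ^ⁿ (b ℕ.+ n ℕ.* (2 ℕ.^ m ℕ.∸ 1)) ≡ x ^ⁿ b
  x^[b+nM]≡x^b {x} x≢0 b n = begin
    x ^ⁿ (b ℕ.+ n ℕ.* M)        ≡⟨ ^-distribˡ-+-* x b (n ℕ.* M) ⟩
    x ^ⁿ b * x ^ⁿ (n ℕ.* M)     ≡⟨ cong (x ^ⁿ b *_) (trans (cong (x ^ⁿ_) (ℕₚ.*-comm n M)) (sym (^-*-assoc x M n))) ⟩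
    x ^ⁿ b * (x ^ⁿ M) ^ⁿ n      ≡⟨ cong (λ y → x ^ⁿ b * y ^ⁿ n) (fermat x≢0) ⟩
    x ^ⁿ b * 1# ^ⁿ n            ≡⟨ cong (x ^ⁿ b *_) (1^n≡1 n) ⟩
    x ^ⁿ b * 1#                 ≡⟨ *-identityʳ _ ⟩
    x ^ⁿ b                      ∎
    where M = 2 ℕ.^ m ℕ.∸ 1

  x^-cong : ∀ {x} → x ≢ 0# → ∀ a b → ℤ.+ (2 ℕ.^ m ℕ.∸ 1) ∣ˢ (ℤ.+ a ℤ.- ℤ.+ b) → x ^ⁿ a ≡ x ^ⁿ b
  x^-cong x≢0 a b a≡b with ∣ˢ[+a-+b]⇒a≡b+nM⊎b≡a+nM a b a≡b
  ... | n , inj₁ a≡b+nM = trans (cong (_ ^ⁿ_) a≡b+nM) (x^[b+nM]≡x^b x≢0 b n)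
  ... | n , inj₂ b≡a+nM = sym (trans (cong (_ ^ⁿ_) b≡a+nM) (x^[b+nM]≡x^b x≢0 a n))

  x*x^[2^m-2]≡1 : ∀ {x} → x ≢ 0# → x * x ^ⁿ (2 ℕ.^ m ℕ.∸ 2) ≡ 1#
  x*x^[2^m-2]≡1 {x} x≢0 = trans (cong (x ^ⁿ_) 1+[2^m-2]≡2^m-1) (fermat x≢0)
    where
    1+[2^m-2]≡2^m-1 : suc (2 ℕ.^ m ℕ.∸ 2) ≡ 2 ℕ.^ m ℕ.∸ 1
    1+[2^m-2]≡2^m-1 = sym (ℕₚ.+-∸-assoc 1 (ℕₚ.^-monoʳ-≤ 2 1≤m))

  module Inverse {k : ℕ} (k≤m : k ≤ m) (1≤k : 1 ≤ k) (d : ℕ)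
                 (d-inverse : ℤ.+ (2 ℕ.^ m ℕ.∸ 1) ℤ∣.∣ (eℤ m k ℤ.* ℤ.+ d ℤ.- ℤ.+ 1)) where

    x^[ed]≡x : ∀ {x} → x ≢ 0# → x ^ⁿ (eNat m k ℕ.* d) ≡ x
    x^[ed]≡x {x} x≢0 = trans (x^-cong x≢0 (eNat m k ℕ.* d) 1 (eNat*d≡1 k≤m 1≤k d-inverse)) (*-identityʳ x)

    x^e*x^[2^k+1]≡1 : ∀ {x} → x ≢ 0# → x ^ⁿ eNat m k * x ^ⁿ (2 ℕ.^ k ℕ.+ 1) ≡ 1#
    x^e*x^[2^k+1]≡1 {x} x≢0 = begin
      x ^ⁿ E * x ^ⁿ (K ℕ.+ 1)   ≡⟨ sym (^-distribˡ-+-* x E (K ℕ.+ 1)) ⟩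
      x ^ⁿ (E ℕ.+ (K ℕ.+ 1))    ≡⟨ cong (x ^ⁿ_) E+K+1≡3M ⟩
      x ^ⁿ (0 ℕ.+ 3 ℕ.* M)      ≡⟨ x^[b+nM]≡x^b x≢0 0 3 ⟩
      1#                        ∎
      where
      E = eNat m k
      K = 2 ℕ.^ k
      M = 2 ℕ.^ m ℕ.∸ 1
      E+K+1≡3M : E ℕ.+ (K ℕ.+ 1) ≡ 3 ℕ.* M
      E+K+1≡3M = ℕₚ.+-cancelʳ-≡ 3 _ _ (begin
        E ℕ.+ (K ℕ.+ 1) ℕ.+ 3      ≡⟨ trans (ℕₚ.+-assoc E (K ℕ.+ 1) 3) (cong (E ℕ.+_) (ℕₚ.+-assoc K 1 3)) ⟩
        E ℕ.+ (K ℕ.+ 4)            ≡⟨ eNat+2^k+4≡3*2^m k≤m 1≤k ⟩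
        3 ℕ.* 2 ℕ.^ m              ≡⟨ cong (3 ℕ.*_) (sym (ℕₚ.m∸n+n≡m (ℕₚ.m^n>0 2 m))) ⟩
        3 ℕ.* (M ℕ.+ 1)            ≡⟨ ℕₚ.*-distribˡ-+ 3 M 1 ⟩
        3 ℕ.* M ℕ.+ 3              ∎)

    κ : ℕ
    κ = (2 ℕ.^ k ℕ.+ 1) ℕ.* d

    x*x^κ≡1 : ∀ {x} → x ≢ 0# → x * x ^ⁿ κ ≡ 1#
    x*x^κ≡1 {x} x≢0 = begin
      x * x ^ⁿ ((K ℕ.+ 1) ℕ.* d)                   ≡⟨ cong₂ _*_ (sym (x^[ed]≡x x≢0)) (sym (^-*-assoc x (K ℕ.+ 1) d)) ⟩
      x ^ⁿ (E ℕ.* d) * (x ^ⁿ (K ℕ.+ 1)) ^ⁿ d        ≡⟨ cong (_* (x ^ⁿ (K ℕ.+ 1)) ^ⁿ d) (sym (^-*-assoc x E d)) ⟩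
      (x ^ⁿ E) ^ⁿ d * (x ^ⁿ (K ℕ.+ 1)) ^ⁿ d        ≡⟨ sym (^-distribʳ-* _ _ d) ⟩
      (x ^ⁿ E * x ^ⁿ (K ℕ.+ 1)) ^ⁿ d               ≡⟨ cong (_^ⁿ d) (x^e*x^[2^k+1]≡1 x≢0) ⟩
      1# ^ⁿ d                                      ≡⟨ 1^n≡1 d ⟩
      1#                                           ∎
      where
      E = eNat m k
      K = 2 ℕ.^ k

    -- Both x^κ and y^(2^m-2) are inverses, of x and of y respectively.
    [x^κ]^[2^m-2]≡x : ∀ {x} → x ≢ 0# → (x ^ⁿ κ) ^ⁿ (2 ℕ.^ m ℕ.∸ 2) ≡ x
    [x^κ]^[2^m-2]≡x {x} x≢0 = inv-unique (x*x^[2^m-2]≡1 (^-≢0 κ x≢0)) (trans (*-comm _ x) (x*x^κ≡1 x≢0))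

module CharacterSumEvaluation {m : ℕ} (F : GF m) {k q r : ℕ} (q≡1+2r : q ≡ suc (2 ℕ.* r)) (k*q≡m : k ℕ.* q ≡ m)
  (d : ℕ) (d-inverse : ℤ.+ (2 ℕ.^ m ℕ.∸ 1) ℤ∣.∣ (eℤ m k ℤ.* ℤ.+ d ℤ.- ℤ.+ 1)) where
  open GF F
  open GFOps F
  open FieldArithmetic F
  open CharacterSums F
  open RelativeTrace F {k} {q} {r} q≡1+2r k*q≡m
  open ExponentArithmetic F using (x*x^[2^m-2]≡1; module Inverse)
  open Inverse k≤m 1≤k d d-inverse
  open ≡-Reasoning

  K : ℕ
  K = 2 ℕ.^ k

  P : ℕ
  P = 2 ℕ.^ m ℕ.∸ 2

  y^[K+1]≡y² : ∀ {y} → Sub y → y ^ⁿ (K ℕ.+ 1) ≡ y ²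
  y^[K+1]≡y² {y} y∈ = trans (^-distribˡ-+-* y K 1) (cong₂ _*_ y∈ (*-identityʳ y))

  module PartI (u v γ : Carrier) (γ∈ : Sub γ) (v≢0 : v ≢ 0#) where
    a : Carrier
    a = pw v d

    a≢0 : a ≢ 0#
    a≢0 = pw-≢0⇒≢0 d v≢0

    z : Carrier
    z = (u * a) ² + γ

    W : Carrier → Carrier
    W x = v * pw x (K ℕ.+ 1)

    W[ya]≡y^[K+1] : ∀ {y} → y ≢ 0# → W (y * a) ≡ y ^ⁿ (K ℕ.+ 1)
    W[ya]≡y^[K+1] {y} y≢0 = begin
      v * pw (y * a) (K ℕ.+ 1)                          ≡⟨ cong (v *_) (trans (pw-≢0 (K ℕ.+ 1) (*-≢0 y≢0 a≢0)) (^-distribʳ-* y a (K ℕ.+ 1))) ⟩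
      v * (y ^ⁿ (K ℕ.+ 1) * a ^ⁿ (K ℕ.+ 1))             ≡⟨ *-swapˡ v _ _ ⟩
      y ^ⁿ (K ℕ.+ 1) * (v * a ^ⁿ (K ℕ.+ 1))             ≡⟨ cong (λ b → y ^ⁿ (K ℕ.+ 1) * (v * b ^ⁿ (K ℕ.+ 1))) (pw-≢0 d v≢0) ⟩
      y ^ⁿ (K ℕ.+ 1) * (v * (v ^ⁿ d) ^ⁿ (K ℕ.+ 1))      ≡⟨ cong (λ b → y ^ⁿ (K ℕ.+ 1) * (v * b)) (trans (^-comm v d (K ℕ.+ 1)) (^-*-assoc v (K ℕ.+ 1) d)) ⟩
      y ^ⁿ (K ℕ.+ 1) * (v * v ^ⁿ κ)                     ≡⟨ cong (y ^ⁿ (K ℕ.+ 1) *_) (x*x^κ≡1 v≢0) ⟩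
      y ^ⁿ (K ℕ.+ 1) * 1#                               ≡⟨ *-identityʳ _ ⟩
      y ^ⁿ (K ℕ.+ 1)                                    ∎

    Sub-y^[K+1]⇒Sub-y : ∀ {y} → y ≢ 0# → Sub (y ^ⁿ (K ℕ.+ 1)) → Sub y
    Sub-y^[K+1]⇒Sub-y {y} y≢0 y^[K+1]∈ =
      subst Sub ([x^κ]^[2^m-2]≡x y≢0) (Sub-^ (subst Sub (^-*-assoc y (K ℕ.+ 1) d) (Sub-^ y^[K+1]∈ d)) P)

    [uya]²+y^[K+1]γ≡y²z : ∀ {y} → Sub y → (u * (y * a)) ² + y ^ⁿ (K ℕ.+ 1) * γ ≡ y ² * z
    [uya]²+y^[K+1]γ≡y²z {y} y∈ = begin
      (u * (y * a)) ² + y ^ⁿ (K ℕ.+ 1) * γ   ≡⟨ cong₂ _+_ (trans (cong _² (*-swapˡ u y a)) (²-* y (u * a))) (cong (_* γ) (y^[K+1]≡y² y∈)) ⟩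
      y ² * (u * a) ² + y ² * γ              ≡⟨ sym (distribˡ _ _ _) ⟩
      y ² * z                                ∎

    term≡ : ∀ {y} → y ≢ 0#
          → sgn (Tr (u * (y * a))) ℤ.* ((ℤ.+ |kerT| ℤ.* sgn (Tr (y ^ⁿ (K ℕ.+ 1) * γ))) when Sub? (y ^ⁿ (K ℕ.+ 1)))
            ≡ (ℤ.+ |kerT| ℤ.* sgn (Tr (y ² * z))) when Sub? (y ²)
    term≡ {y} y≢0 with Sub? y
    ... | no y∉ = trans (cong (sgn (Tr (u * (y * a))) ℤ.*_) (when-no (Sub? Y) _ (λ Y∈ → y∉ (Sub-y^[K+1]⇒Sub-y y≢0 Y∈))))
                        (trans (ℤₚ.*-zeroʳ (sgn (Tr (u * (y * a))))) (sym (when-no (Sub? (y ²)) _ (λ y²∈ → y∉ (Sub-√ y²∈)))))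
      where Y = y ^ⁿ (K ℕ.+ 1)
    ... | yes y∈ = begin
      sgn (Tr (u * (y * a))) ℤ.* ((ℤ.+ |kerT| ℤ.* sgn (Tr (Y * γ))) when Sub? Y)
        ≡⟨ cong (sgn (Tr (u * (y * a))) ℤ.*_) (when-yes (Sub? Y) _ (Sub-^ y∈ (K ℕ.+ 1))) ⟩
      sgn (Tr (u * (y * a))) ℤ.* (ℤ.+ |kerT| ℤ.* sgn (Tr (Y * γ)))
        ≡⟨ cong (λ t → sgn t ℤ.* (ℤ.+ |kerT| ℤ.* sgn (Tr (Y * γ)))) (sym (Tr-² _)) ⟩
      sgn (Tr ((u * (y * a)) ²)) ℤ.* (ℤ.+ |kerT| ℤ.* sgn (Tr (Y * γ)))
        ≡⟨ sgn-Tr-*-combine ((u * (y * a)) ²) (ℤ.+ |kerT|) (Y * γ) ⟩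
      ℤ.+ |kerT| ℤ.* sgn (Tr ((u * (y * a)) ² + Y * γ))
        ≡⟨ cong (λ t → ℤ.+ |kerT| ℤ.* sgn (Tr t)) ([uya]²+y^[K+1]γ≡y²z y∈) ⟩
      ℤ.+ |kerT| ℤ.* sgn (Tr (y ² * z))
        ≡⟨ sym (when-yes (Sub? (y ²)) _ (Sub-² y∈)) ⟩
      (ℤ.+ |kerT| ℤ.* sgn (Tr (y ² * z))) when Sub? (y ²) ∎
      where Y = y ^ⁿ (K ℕ.+ 1)

    summand≡ : ∀ y → fiberSummand (λ x → sgn (Tr (u * x))) W γ (y * a) ≡ subfieldSummand z (y ²)
    summand≡ y with y ≟ 0#
    ... | yes refl = trans (when-no (NonZero? (0# * a)) _ (λ 0a≢0 → 0a≢0 (zeroˡ a)))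
                           (sym (when-no (NonZero? (0# ²)) _ (λ 0²≢0 → 0²≢0 (zeroˡ 0#))))
    ... | no y≢0 = begin
      fiberSummand (λ x → sgn (Tr (u * x))) W γ (y * a)
        ≡⟨ when-yes (NonZero? (y * a)) _ (*-≢0 y≢0 a≢0) ⟩
      sgn (Tr (u * (y * a))) ℤ.* ((ℤ.+ |kerT| ℤ.* sgn (Tr (W (y * a) * γ))) when Sub? (W (y * a)))
        ≡⟨ cong (λ w → sgn (Tr (u * (y * a))) ℤ.* ((ℤ.+ |kerT| ℤ.* sgn (Tr (w * γ))) when Sub? w)) (W[ya]≡y^[K+1] y≢0) ⟩
      sgn (Tr (u * (y * a))) ℤ.* ((ℤ.+ |kerT| ℤ.* sgn (Tr (y ^ⁿ (K ℕ.+ 1) * γ))) when Sub? (y ^ⁿ (K ℕ.+ 1)))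
        ≡⟨ term≡ y≢0 ⟩
      (ℤ.+ |kerT| ℤ.* sgn (Tr (y ² * z))) when Sub? (y ²)
        ≡⟨ sym (when-yes (NonZero? (y ²)) _ (²-≢0 y≢0)) ⟩
      subfieldSummand z (y ²) ∎

    Ω≡subfieldSum : Ω F k q u v γ ≡ subfieldSum z
    Ω≡subfieldSum = begin
      Ω F k q u v γ
        ≡⟨ sumℤ-cong (filter (λ s → T s ≟ γ) elems) (λ s → sumℤ-cong nonzero (λ x → cong (λ t → sgn (Tr (u * x)) ℤ.* sgn (Tr t)) (vs*p≡vp*s s x))) ⟩
      sumFiber k q γ (λ s → sumNZ (λ x → sgn (Tr (u * x)) ℤ.* sgn (Tr (W x * s))))
        ≡⟨ sumFiber≡sumAll-fiberSummand γ∈ (λ x → sgn (Tr (u * x))) W ⟩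
      sumAll (fiberSummand (λ x → sgn (Tr (u * x))) W γ)
        ≡⟨ sym (sumAll-dilate a≢0 _) ⟩
      sumAll (λ y → fiberSummand (λ x → sgn (Tr (u * x))) W γ (y * a))
        ≡⟨ fold-cong elems summand≡ ⟩
      sumAll (λ y → subfieldSummand z (y ²))
        ≡⟨ sumAll-square (subfieldSummand z) ⟩
      subfieldSum z ∎
      where
      vs*p≡vp*s : ∀ s x → v * s * pw x (K ℕ.+ 1) ≡ W x * s
      vs*p≡vp*s s x = trans (*-assoc v s _) (trans (cong (v *_) (*-comm s _)) (sym (*-assoc v _ s)))

    Tz≡T[ua]²+γ : T z ≡ (T (u * a)) ² + γ
    Tz≡T[ua]²+γ = trans (T-+ _ γ) (cong₂ _+_ (T-² _) (T-Sub γ∈))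

    Ω-big : γ ≡ pw (T (u * a)) 2 → Ω F k q u v γ ≡ bigVal m k
    Ω-big γ≡ = trans Ω≡subfieldSum (subfieldSum-ker (trans Tz≡T[ua]²+γ (trans (cong ((T (u * a)) ² +_) (trans γ≡ (pw-2 _))) (x+x≡0 _))))

    Ω-small : γ ≢ pw (T (u * a)) 2 → Ω F k q u v γ ≡ smallVal m k
    Ω-small γ≢ = trans Ω≡subfieldSum (subfieldSum-∉ker (λ Tz≡0 → γ≢ (trans (sym (x+y≡0⇒x≡y (trans (sym Tz≡T[ua]²+γ) Tz≡0))) (sym (pw-2 _)))))

  module PartII (u v γ : Carrier) (γ∈ : Sub γ) (u≢0 : u ≢ 0#) where
    a : Carrier
    a = pw u (eNat m k)

    a≢0 : a ≢ 0#
    a≢0 = pw-≢0⇒≢0 (eNat m k) u≢0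

    z : Carrier
    z = v * a + γ ²

    W : Carrier → Carrier
    W x = u * pw⁻ x d

    W[ca]≡c^[Pd] : ∀ {c} → c ≢ 0# → W (c * a) ≡ c ^ⁿ (P ℕ.* d)
    W[ca]≡c^[Pd] {c} c≢0 = begin
      u * pw (c * a) (P ℕ.* d)                   ≡⟨ cong (u *_) (trans (pw-≢0 (P ℕ.* d) (*-≢0 c≢0 a≢0)) (^-distribʳ-* c a (P ℕ.* d))) ⟩
      u * (c ^ⁿ (P ℕ.* d) * a ^ⁿ (P ℕ.* d))      ≡⟨ *-swapˡ u _ _ ⟩
      c ^ⁿ (P ℕ.* d) * (u * a ^ⁿ (P ℕ.* d))      ≡⟨ cong (λ b → c ^ⁿ (P ℕ.* d) * (u * b)) a^[Pd]≡u^P ⟩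
      c ^ⁿ (P ℕ.* d) * (u * u ^ⁿ P)              ≡⟨ cong (c ^ⁿ (P ℕ.* d) *_) (x*x^[2^m-2]≡1 u≢0) ⟩
      c ^ⁿ (P ℕ.* d) * 1#                        ≡⟨ *-identityʳ _ ⟩
      c ^ⁿ (P ℕ.* d)                             ∎
      where
      a^[Pd]≡u^P : a ^ⁿ (P ℕ.* d) ≡ u ^ⁿ P
      a^[Pd]≡u^P = begin
        a ^ⁿ (P ℕ.* d)                    ≡⟨ cong (_^ⁿ (P ℕ.* d)) (pw-≢0 (eNat m k) u≢0) ⟩
        (u ^ⁿ eNat m k) ^ⁿ (P ℕ.* d)      ≡⟨ sym (^-*-assoc _ P d) ⟩
        ((u ^ⁿ eNat m k) ^ⁿ P) ^ⁿ d       ≡⟨ ^-comm _ P d ⟩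
        ((u ^ⁿ eNat m k) ^ⁿ d) ^ⁿ P       ≡⟨ cong (_^ⁿ P) (trans (^-*-assoc u (eNat m k) d) (x^[ed]≡x u≢0)) ⟩
        u ^ⁿ P                            ∎

    [c^[Pd]]^[K+1]≡c : ∀ {c} → c ≢ 0# → (c ^ⁿ (P ℕ.* d)) ^ⁿ (K ℕ.+ 1) ≡ c
    [c^[Pd]]^[K+1]≡c {c} c≢0 = begin
      (c ^ⁿ (P ℕ.* d)) ^ⁿ (K ℕ.+ 1)   ≡⟨ cong (_^ⁿ (K ℕ.+ 1)) (sym (^-*-assoc c P d)) ⟩
      (c⁻¹ ^ⁿ d) ^ⁿ (K ℕ.+ 1)         ≡⟨ trans (^-comm c⁻¹ d (K ℕ.+ 1)) (^-*-assoc c⁻¹ (K ℕ.+ 1) d) ⟩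
      c⁻¹ ^ⁿ κ                        ≡⟨ inv-unique (x*x^κ≡1 (^-≢0 P c≢0)) (trans (*-comm c⁻¹ c) (x*x^[2^m-2]≡1 c≢0)) ⟩
      c                               ∎
      where c⁻¹ = c ^ⁿ P

    v[ca]+[Cγ]²≡cz : ∀ {c} → c ≢ 0# → Sub (c ^ⁿ (P ℕ.* d)) → v * (c * a) + (c ^ⁿ (P ℕ.* d) * γ) ² ≡ c * z
    v[ca]+[Cγ]²≡cz {c} c≢0 C∈ = begin
      v * (c * a) + (c ^ⁿ (P ℕ.* d) * γ) ²
        ≡⟨ cong₂ _+_ (*-swapˡ v c a) (trans (²-* _ γ) (cong (_* γ ²) (trans (sym (y^[K+1]≡y² C∈)) ([c^[Pd]]^[K+1]≡c c≢0)))) ⟩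
      c * (v * a) + c * γ ²                  ≡⟨ sym (distribˡ _ _ _) ⟩
      c * z                                  ∎

    term≡ : ∀ {c} → c ≢ 0#
          → sgn (Tr (v * (c * a))) ℤ.* ((ℤ.+ |kerT| ℤ.* sgn (Tr (c ^ⁿ (P ℕ.* d) * γ))) when Sub? (c ^ⁿ (P ℕ.* d)))
            ≡ (ℤ.+ |kerT| ℤ.* sgn (Tr (c * z))) when Sub? c
    term≡ {c} c≢0 with Sub? c
    ... | no c∉ = trans (cong (sgn (Tr (v * (c * a))) ℤ.*_)
                            (when-no (Sub? C) _ (λ C∈ → c∉ (subst Sub ([c^[Pd]]^[K+1]≡c c≢0) (Sub-^ C∈ (K ℕ.+ 1))))))
                        (ℤₚ.*-zeroʳ (sgn (Tr (v * (c * a)))))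
      where C = c ^ⁿ (P ℕ.* d)
    ... | yes c∈ = begin
      sgn (Tr (v * (c * a))) ℤ.* ((ℤ.+ |kerT| ℤ.* sgn (Tr (C * γ))) when Sub? C)
        ≡⟨ cong (sgn (Tr (v * (c * a))) ℤ.*_) (when-yes (Sub? C) _ C∈) ⟩
      sgn (Tr (v * (c * a))) ℤ.* (ℤ.+ |kerT| ℤ.* sgn (Tr (C * γ)))
        ≡⟨ cong (λ t → sgn (Tr (v * (c * a))) ℤ.* (ℤ.+ |kerT| ℤ.* sgn t)) (sym (Tr-² _)) ⟩
      sgn (Tr (v * (c * a))) ℤ.* (ℤ.+ |kerT| ℤ.* sgn (Tr ((C * γ) ²)))
        ≡⟨ sgn-Tr-*-combine (v * (c * a)) (ℤ.+ |kerT|) ((C * γ) ²) ⟩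
      ℤ.+ |kerT| ℤ.* sgn (Tr (v * (c * a) + (C * γ) ²))
        ≡⟨ cong (λ t → ℤ.+ |kerT| ℤ.* sgn (Tr t)) (v[ca]+[Cγ]²≡cz c≢0 C∈) ⟩
      ℤ.+ |kerT| ℤ.* sgn (Tr (c * z)) ∎
      where
      C = c ^ⁿ (P ℕ.* d)
      C∈ : Sub C
      C∈ = Sub-^ c∈ (P ℕ.* d)

    summand≡ : ∀ c → fiberSummand (λ x → sgn (Tr (v * x))) W γ (c * a) ≡ subfieldSummand z c
    summand≡ c with c ≟ 0#
    ... | yes refl = when-no (NonZero? (0# * a)) _ (λ 0a≢0 → 0a≢0 (zeroˡ a))
    ... | no c≢0 = begin
      fiberSummand (λ x → sgn (Tr (v * x))) W γ (c * a)
        ≡⟨ when-yes (NonZero? (c * a)) _ (*-≢0 c≢0 a≢0) ⟩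
      sgn (Tr (v * (c * a))) ℤ.* ((ℤ.+ |kerT| ℤ.* sgn (Tr (W (c * a) * γ))) when Sub? (W (c * a)))
        ≡⟨ cong (λ w → sgn (Tr (v * (c * a))) ℤ.* ((ℤ.+ |kerT| ℤ.* sgn (Tr (w * γ))) when Sub? w)) (W[ca]≡c^[Pd] c≢0) ⟩
      sgn (Tr (v * (c * a))) ℤ.* ((ℤ.+ |kerT| ℤ.* sgn (Tr (c ^ⁿ (P ℕ.* d) * γ))) when Sub? (c ^ⁿ (P ℕ.* d)))
        ≡⟨ term≡ c≢0 ⟩
      (ℤ.+ |kerT| ℤ.* sgn (Tr (c * z))) when Sub? c ∎

    Υ≡subfieldSum : Υ F k q d u v γ ≡ subfieldSum z
    Υ≡subfieldSum = begin
      Υ F k q d u v γ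
        ≡⟨ sumℤ-cong (filter (λ s → T s ≟ γ) elems) (λ s → sumℤ-cong nonzero (λ x → reorder s x)) ⟩
      sumFiber k q γ (λ s → sumNZ (λ x → sgn (Tr (v * x)) ℤ.* sgn (Tr (W x * s))))
        ≡⟨ sumFiber≡sumAll-fiberSummand γ∈ (λ x → sgn (Tr (v * x))) W ⟩
      sumAll (fiberSummand (λ x → sgn (Tr (v * x))) W γ)
        ≡⟨ sym (sumAll-dilate a≢0 _) ⟩
      sumAll (λ c → fiberSummand (λ x → sgn (Tr (v * x))) W γ (c * a))
        ≡⟨ fold-cong elems summand≡ ⟩
      subfieldSum z ∎
      where
      reorder : ∀ s x → sgn (Tr (u * s * pw⁻ x d)) ℤ.* sgn (Tr (v * x)) ≡ sgn (Tr (v * x)) ℤ.* sgn (Tr (W x * s))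
      reorder s x = trans (ℤₚ.*-comm (sgn (Tr (u * s * pw⁻ x d))) _)
        (cong (λ t → sgn (Tr (v * x)) ℤ.* sgn (Tr t)) (trans (*-assoc u s _) (trans (cong (u *_) (*-comm s _)) (sym (*-assoc u _ s)))))

    Tz≡T[va]+γ² : T z ≡ T (v * a) + γ ²
    Tz≡T[va]+γ² = trans (T-+ _ _) (cong (T (v * a) +_) (T-Sub (Sub-² γ∈)))

    Υ-big : pw γ 2 ≡ T (v * a) → Υ F k q d u v γ ≡ bigVal m k
    Υ-big γ²≡ = trans Υ≡subfieldSum (subfieldSum-ker (trans Tz≡T[va]+γ² (trans (cong (T (v * a) +_) (trans (sym (pw-2 γ)) γ²≡)) (x+x≡0 _))))

    Υ-small : pw γ 2 ≢ T (v * a) → Υ F k q d u v γ ≡ smallVal m k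
    Υ-small γ²≢ = trans Υ≡subfieldSum (subfieldSum-∉ker (λ Tz≡0 → γ²≢ (trans (pw-2 γ) (sym (x+y≡0⇒x≡y (trans (sym Tz≡T[va]+γ²) Tz≡0))))))

even-or-odd : ∀ n → ∃ λ r → n ≡ 2 ℕ.* r ⊎ n ≡ suc (2 ℕ.* r)
even-or-odd zero    = 0 , inj₁ refl
even-or-odd (suc n) with even-or-odd n
... | r , inj₁ n≡2r   = r , inj₂ (cong suc n≡2r)
... | r , inj₂ n≡1+2r = suc r , inj₁ (trans (cong suc n≡1+2r) (sym (ℕₚ.*-suc 2 r)))

-- (b+1)² = 1 + b(b+2), so every power of (b+1)² is 1 modulo b+2.
[a*a]^r≡1+t[a+1] : ∀ b r → ∃ λ t → (suc b ℕ.* suc b) ℕ.^ r ≡ suc (t ℕ.* (suc b ℕ.+ 1))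
[a*a]^r≡1+t[a+1] b zero    = 0 , refl
[a*a]^r≡1+t[a+1] b (suc r) with [a*a]^r≡1+t[a+1] b r
... | t , X≡1+tA = b ℕ.+ t ℕ.+ b ℕ.* t ℕ.* (suc b ℕ.+ 1) , trans (cong (suc b ℕ.* suc b ℕ.*_) X≡1+tA) (multiply b t)
  where
  multiply : ∀ b t → suc b ℕ.* suc b ℕ.* suc (t ℕ.* (suc b ℕ.+ 1))
                   ≡ suc ((b ℕ.+ t ℕ.+ b ℕ.* t ℕ.* (suc b ℕ.+ 1)) ℕ.* (suc b ℕ.+ 1))
  multiply = ℕ-Solver.solve-∀

a+1∣[a*a]^r∸1 : ∀ a r → 0 < a → a ℕ.+ 1 ℕ∣.∣ (a ℕ.* a) ℕ.^ r ℕ.∸ 1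
a+1∣[a*a]^r∸1 (suc b) r _ with [a*a]^r≡1+t[a+1] b r
... | t , X≡1+tA = ℕ∣.divides t (cong (ℕ._∸ 1) X≡1+tA)

*-quotient≡ : ∀ {k m} (k∣m : k ℕ∣.∣ m) → k ℕ.* ℕ∣._∣_.quotient k∣m ≡ m
*-quotient≡ {k} k∣m = trans (ℕₚ.*-comm k _) (sym (ℕ∣._∣_.equality k∣m))

-- If q were even, 2^k + 1 would divide both 2^m - 1 and itself.
gcd≡1⇒odd : ∀ {m k q} → k ℕ.* q ≡ m → gcd (2 ℕ.^ m ℕ.∸ 1) (2 ℕ.^ k ℕ.+ 1) ≡ 1 → ∃ λ r → q ≡ suc (2 ℕ.* r)
gcd≡1⇒odd {m} {k} {q} k*q≡m gcd≡1 with even-or-odd q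
... | r , inj₂ q≡1+2r = r , q≡1+2r
... | r , inj₁ q≡2r   = contradiction (ℕ∣.∣1⇒≡1 (subst (2 ℕ.^ k ℕ.+ 1 ℕ∣.∣_) gcd≡1 (gcd-greatest ∣2^m-1 ℕ∣.∣-refl)))
                                      (ℕₚ.>⇒≢ (ℕₚ.+-monoˡ-< 1 (ℕₚ.m^n>0 2 k)))
  where
  2^m≡[2^k*2^k]^r : 2 ℕ.^ m ≡ (2 ℕ.^ k ℕ.* 2 ℕ.^ k) ℕ.^ r
  2^m≡[2^k*2^k]^r = begin
    2 ℕ.^ m                         ≡⟨ cong (2 ℕ.^_) (trans (sym k*q≡m) (trans (cong (k ℕ.*_) q≡2r) (sym (ℕₚ.*-assoc k 2 r)))) ⟩
    2 ℕ.^ (k ℕ.* 2 ℕ.* r)           ≡⟨ sym (ℕₚ.^-*-assoc 2 (k ℕ.* 2) r) ⟩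
    (2 ℕ.^ (k ℕ.* 2)) ℕ.^ r         ≡⟨ cong (λ n → (2 ℕ.^ n) ℕ.^ r) (trans (ℕₚ.*-comm k 2) (cong (k ℕ.+_) (ℕₚ.+-identityʳ k))) ⟩
    (2 ℕ.^ (k ℕ.+ k)) ℕ.^ r         ≡⟨ cong (ℕ._^ r) (ℕₚ.^-distribˡ-+-* 2 k k) ⟩
    (2 ℕ.^ k ℕ.* 2 ℕ.^ k) ℕ.^ r     ∎
    where open ≡-Reasoning
  ∣2^m-1 : 2 ℕ.^ k ℕ.+ 1 ℕ∣.∣ 2 ℕ.^ m ℕ.∸ 1
  ∣2^m-1 = subst (λ n → 2 ℕ.^ k ℕ.+ 1 ℕ∣.∣ n ℕ.∸ 1) (sym 2^m≡[2^k*2^k]^r) (a+1∣[a*a]^r∸1 (2 ℕ.^ k) r (ℕₚ.m^n>0 2 k))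

open import Data.Nat using (ℕ; _^_; _∸_; _+_)
open import Data.Nat.Divisibility using (_∣_)
open import Data.Nat.GCD using (gcd)
open import Data.Integer using (ℤ; +_; _*_; _-_)
open import Data.Integer.Divisibility using () renaming (_∣_ to _∣ℤ_)
open import Data.Product using (_×_)
open import Relation.Binary.PropositionalEquality using (_≡_; _≢_)

lemma11 : (m k : ℕ) (kdm : k ∣ m) → gcd (2 ^ m ∸ 1) (2 ^ k + 1) ≡ 1
  → (d : ℕ) → (+ (2 ^ m ∸ 1)) ∣ℤ (eℤ m k * + d - + 1)
  → (F : GF m) → (u v γ : GF.Carrier F) → GFOps.InSubfield F k γ
  → ((v ≢ GF.0# F
       → (γ ≡ GFOps.pw F (GFOps.RelTr F k (_∣_.quotient kdm) (GF._*_ F u (GFOps.pw F v d))) 2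
           → Ω F k (_∣_.quotient kdm) u v γ ≡ bigVal m k)
       × (γ ≢ GFOps.pw F (GFOps.RelTr F k (_∣_.quotient kdm) (GF._*_ F u (GFOps.pw F v d))) 2
           → Ω F k (_∣_.quotient kdm) u v γ ≡ smallVal m k))
    × (u ≢ GF.0# F
       → (GFOps.pw F γ 2 ≡ GFOps.RelTr F k (_∣_.quotient kdm) (GF._*_ F v (GFOps.pw F u (eNat m k)))
           → Υ F k (_∣_.quotient kdm) d u v γ ≡ bigVal m k)
       × (GFOps.pw F γ 2 ≢ GFOps.RelTr F k (_∣_.quotient kdm) (GF._*_ F v (GFOps.pw F u (eNat m k)))
           → Υ F k (_∣_.quotient kdm) d u v γ ≡ smallVal m k)))
lemma11 m k kdm gcd≡1 d d-inverse F u v γ γ∈ with gcd≡1⇒odd {m} {k} (*-quotient≡ kdm) gcd≡1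
... | r , q≡1+2r = (λ v≢0 → PartI.Ω-big u v γ γ∈ v≢0 , PartI.Ω-small u v γ γ∈ v≢0)
                 , (λ u≢0 → PartII.Υ-big u v γ γ∈ u≢0 , PartII.Υ-small u v γ γ∈ u≢0)
  where open CharacterSumEvaluation F {k} {r = r} q≡1+2r (*-quotient≡ kdm) d d-inverse
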